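{- $\mathbf{INF}^\iota$ is equivalent to $\mathbf{INF}^{LL\Delta}$ in the following sense: (a) if $\Gamma\vdash A$ in $\mathbf{INF}^\iota$, then $\upsilon(\Gamma)\vdash\upsilon(A)$ in $\mathbf{INF}^{LL\Delta}$; (b) if $\Gamma\vdash A$ in $\mathbf{INF}^{LL\Delta}$, then $\tau(\Gamma)\vdash\tau(A)$ in $\mathbf{INF}^\iota$, where $\tau$ and $\upsilon$ are the translations described below and $\tau(\Gamma),\upsilon(\Gamma)$ denote the sets of translated formulas of $\Gamma$.
   Context: $\mathbf{INF}$ (intuitionist negative free logic) is a natural deduction system for a first-order language with predicate letters, identity $=$, a unary existence predicate $\exists!$ applicable to terms, connectives $\land,\lor,\rightarrow,\leftrightarrow,\bot$ (with $\neg A$ as $A\rightarrow\bot$) and quantifiers $\forall,\exists$. $A^x_t$ denotes substitution of $t$ for free $x$ in $A$. Rules: the usual intuitionistic rules for $\land,\lor,\rightarrow,\leftrightarrow$; $\bot E$ restricted to atomic conclusions; $\forall I$: from a derivation of $A^x_y$ in which the only open assumption containing $y$ free is $\exists!y$, infer $\forall xA$ discharging $\exists!y$; $\forall E$: from $\forall xA$ and $\exists!t$ infer $A^x_t$; $\exists I$: from $A^x_t$ and $\exists!t$ infer $\exists xA$; $\exists E$: from $\exists xA$ and a derivation of $C$ from $A^x_y,\exists!y$ infer $C$ discharging them (usual eigenvariable conditions); $=I^n$: from $\exists!t$ infer $t=t$; $=E$: from $t_1=t_2$ and atomic $A^x_{t_1}$ infer $A^x_{t_2}$; $AD$: from an atomic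 $Pt_1\dots t_n$ (including identities) infer $\exists!t_i$. $\mathbf{INF}^\iota$: $\mathbf{INF}$ extended by a binary quantifier $\iota$ forming formulas $\iota x[F,G]$ ("the $F$ is $G$", binding $x$ in $F$ and $G$), with rules: $\iota I$: from $F^x_t$, $G^x_t$, $\exists!t$ and a derivation of $z=t$ from assumptions $F^x_z,\exists!z$ ($z$ distinct from $x$, not free in $t$ or in other open assumptions), infer $\iota x[F,G]$ discharging them; $\iota E^1$: from $\iota x[F,G]$ and a derivation of $C$ from $F^x_z,G^x_z,\exists!z$ infer $C$ discharging them ($z$ not free in $C$ or other open assumptions; $z=x$ or $z$ not free in $F,G$); $\iota E^2$: from $\iota x[F,G]$, $\exists!t_1$, $\exists!t_2$, $F^x_{t_1}$, $F^x_{t_2}$ infer $t_1=t_2$. $\mathbf{INF}^{LL\Delta}$: the language of $\mathbf{INF}$ extended by a term-forming description operator $\iota$ (terms $\iota xA$) and a predicate abstraction operator $\Delta$ forming unary predicate terms $\Delta xB$ from formulas $B$, with formulas $\Delta xB, t$ ("$t$ is $B$") for any term $t$; only unary abstraction is considered. Primary occurrences of $\iota$-terms are those flanking $=$. The system is $\mathbf{INF}$ plus the axiom schemas: Lambert's Law $\forall y(\iota xA=y\leftrightarrow\forall x(A\leftrightarrow x=y))$; $(\Delta t)$ $\Delta xB,t\leftrightarrow(\exists!t\land B^x_t)$ ($t$ free for $x$ in $B$, $x$ not free in $t$); $(\Delta\iota)$ $\Delta xB,\iota xA\leftrightarrow\exists z(\iota xA=z\land B^x_z)$. Translation $\tau$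 from the language of $\mathbf{INF}^{LL\Delta}$ to that of $\mathbf{INF}^\iota$: atomic formulas without $\iota$-terms are unchanged; $\tau$ commutes with $\neg,\forall,\exists$ and binary connectives; $\tau(\iota xA=t)=\iota x[\tau(A),x=t]$, similarly for $t=\iota xA$ (so $\tau(\iota xA=\iota yB)=\iota x[\tau(A),\iota y[\tau(B),x=y]]$); if $t$ is not an $\iota$-term, $\tau(\Delta xB,t)=\iota x[t=x,\tau(B)]$; $\tau(\Delta xB,\iota xA)=\iota x[\tau(A),\tau(B)]$. Translation $\upsilon$ from the language of $\mathbf{INF}^\iota$ to that of $\mathbf{INF}^{LL\Delta}$: unchanged on atomic formulas, commuting with the connectives and quantifiers, and $\upsilon(\iota x[A,B])=\Delta x\,\upsilon(B),\iota x\,\upsilon(A)$. -}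

module Defs where

-- Syntax is locally nameless / well-scoped de Bruijn:
--   * bound variables are de Bruijn indices  bv i  with  i : Fin n,
--   * free variables (parameters, eigenvariables) are names  fv a  (a : ℕ),
--   * individual constants  con c.
-- A formula  Form (suc n)  is the body of a binder; binder x is index 0.
-- A^x_t  is  open A t  (instantiate index 0 by t).

open import Data.Nat using (ℕ; zero; suc)
open import Data.Fin using (Fin; zero; suc; inject₁)
open import Data.List using (List; []; _∷_; _++_; map; concatMap)
open import Data.List.Membership.Propositional using (_∈_; _∉_)
open import Data.Maybe using (Maybe; just; nothing)
open import Relation.Binary.PropositionalEquality using (_≡_)

private
  variable
    n m : ℕ

data Term (n : ℕ) : Set where
  bv  : Fin n → Term n
  fv  : ℕ → Term n
  con : ℕ → Term n

liftR : (Fin n → Fin m) → Fin (suc n) → Fin (suc m)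
liftR ρ zero    = zero
liftR ρ (suc i) = suc (ρ i)

renT : (Fin n → Fin m) → Term n → Term m
renT ρ (bv i)  = bv (ρ i)
renT ρ (fv a)  = fv a
renT ρ (con c) = con c

liftS : (Fin n → Term m) → Fin (suc n) → Term (suc m)
liftS σ zero    = bv zero
liftS σ (suc i) = renT suc (σ i)

subT : (Fin n → Term m) → Term n → Term m
subT σ (bv i)  = σ i
subT σ (fv a)  = fv a
subT σ (con c) = con c

single : Term n → Fin (suc n) → Term n
single t zero    = t
single t (suc i) = bv i

namesT : Term n → List ℕ
namesT (bv i)  = []
namesT (fv a)  = a ∷ []
namesT (con c) = []

module Iota where

  infixr 4 _⇒_ _⇔_
  infixr 5 _∨'_
  infixr 6 _∧'_
  infix  7 _≐_
  infix  2 _⊢_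

  data Form (n : ℕ) : Set where
    pred : ℕ → List (Term n) → Form n
    E!   : Term n → Form n
    _≐_  : Term n → Term n → Form n
    ⊥'   : Form n
    _∧'_ _∨'_ _⇒_ _⇔_ : Form n → Form n → Form n
    all ex : Form (suc n) → Form n
    the  : Form (suc n) → Form (suc n) → Form n

  ¬' : Form n → Form n
  ¬' A = A ⇒ ⊥'

  renF : (Fin n → Fin m) → Form n → Form m
  renF ρ (pred P ts) = pred P (map (renT ρ) ts)
  renF ρ (E! t)      = E! (renT ρ t)
  renF ρ (s ≐ t)     = renT ρ s ≐ renT ρ t
  renF ρ ⊥'          = ⊥'
  renF ρ (A ∧' B)    = renF ρ A ∧' renF ρ B
  renF ρ (A ∨' B)    = renF ρ A ∨' renF ρ B
  renF ρ (A ⇒ B)     = renF ρ A ⇒ renF ρ B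
  renF ρ (A ⇔ B)     = renF ρ A ⇔ renF ρ B
  renF ρ (all A)     = all (renF (liftR ρ) A)
  renF ρ (ex A)      = ex (renF (liftR ρ) A)
  renF ρ (the F G)   = the (renF (liftR ρ) F) (renF (liftR ρ) G)

  subF : (Fin n → Term m) → Form n → Form m
  subF σ (pred P ts) = pred P (map (subT σ) ts)
  subF σ (E! t)      = E! (subT σ t)
  subF σ (s ≐ t)     = subT σ s ≐ subT σ t
  subF σ ⊥'          = ⊥'
  subF σ (A ∧' B)    = subF σ A ∧' subF σ B
  subF σ (A ∨' B)    = subF σ A ∨' subF σ B
  subF σ (A ⇒ B)     = subF σ A ⇒ subF σ B
  subF σ (A ⇔ B)     = subF σ A ⇔ subF σ B
  subF σ (all A)     = all (subF (liftS σ) A)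
  subF σ (ex A)      = ex (subF (liftS σ) A)
  subF σ (the F G)   = the (subF (liftS σ) F) (subF (liftS σ) G)

  open₁ : Form (suc n) → Term n → Form n
  open₁ A t = subF (single t) A

  names : Form n → List ℕ
  names (pred P ts) = concatMap namesT ts
  names (E! t)      = namesT t
  names (s ≐ t)     = namesT s ++ namesT t
  names ⊥'          = []
  names (A ∧' B)    = names A ++ names B
  names (A ∨' B)    = names A ++ names B
  names (A ⇒ B)     = names A ++ names B
  names (A ⇔ B)     = names A ++ names B
  names (all A)     = names A
  names (ex A)      = names A
  names (the F G)   = names F ++ names G

  namesCtx : List (Form 0) → List ℕ
  namesCtx Γ = concatMap names Γ

  data Atomic {n : ℕ} : Form n → Set where
    at-pred : ∀ {P ts} → Atomic (pred P ts)
    at-E!   : ∀ {t} → Atomic (E! t)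
    at-≐    : ∀ {s t} → Atomic (s ≐ t)

  data _⊢_ (Γ : List (Form 0)) : Form 0 → Set where
    ass  : ∀ {A} → A ∈ Γ → Γ ⊢ A
    ∧I   : ∀ {A B} → Γ ⊢ A → Γ ⊢ B → Γ ⊢ A ∧' B
    ∧E₁  : ∀ {A B} → Γ ⊢ A ∧' B → Γ ⊢ A
    ∧E₂  : ∀ {A B} → Γ ⊢ A ∧' B → Γ ⊢ B
    ∨I₁  : ∀ {A B} → Γ ⊢ A → Γ ⊢ A ∨' B
    ∨I₂  : ∀ {A B} → Γ ⊢ B → Γ ⊢ A ∨' B
    ∨E   : ∀ {A B C} → Γ ⊢ A ∨' B → (A ∷ Γ) ⊢ C → (B ∷ Γ) ⊢ C → Γ ⊢ C
    ⇒I   : ∀ {A B} → (A ∷ Γ) ⊢ B → Γ ⊢ A ⇒ B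
    ⇒E   : ∀ {A B} → Γ ⊢ A ⇒ B → Γ ⊢ A → Γ ⊢ B
    ⇔I   : ∀ {A B} → (A ∷ Γ) ⊢ B → (B ∷ Γ) ⊢ A → Γ ⊢ A ⇔ B
    ⇔E₁  : ∀ {A B} → Γ ⊢ A ⇔ B → Γ ⊢ A → Γ ⊢ B
    ⇔E₂  : ∀ {A B} → Γ ⊢ A ⇔ B → Γ ⊢ B → Γ ⊢ A
    ⊥E   : ∀ {A} → Atomic A → Γ ⊢ ⊥' → Γ ⊢ A
    ∀I   : ∀ {A} (y : ℕ) → y ∉ namesCtx Γ → y ∉ names A →
           (E! (fv y) ∷ Γ) ⊢ open₁ A (fv y) → Γ ⊢ all A
    ∀E   : ∀ {A t} → Γ ⊢ all A → Γ ⊢ E! t → Γ ⊢ open₁ A t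
    ∃I   : ∀ {A t} → Γ ⊢ open₁ A t → Γ ⊢ E! t → Γ ⊢ ex A
    ∃E   : ∀ {A C} (y : ℕ) → y ∉ namesCtx Γ → y ∉ names A → y ∉ names C →
           Γ ⊢ ex A → (open₁ A (fv y) ∷ E! (fv y) ∷ Γ) ⊢ C → Γ ⊢ C
    =Iⁿ  : ∀ {t} → Γ ⊢ E! t → Γ ⊢ t ≐ t
    =E   : ∀ {t₁ t₂} (A : Form 1) → Atomic A →
           Γ ⊢ t₁ ≐ t₂ → Γ ⊢ open₁ A t₁ → Γ ⊢ open₁ A t₂
    AD-pred : ∀ {P ts t} → Γ ⊢ pred P ts → t ∈ ts → Γ ⊢ E! t
    AD-E!   : ∀ {t} → Γ ⊢ E! t → Γ ⊢ E! t
    AD-≐₁   : ∀ {t₁ t₂} → Γ ⊢ t₁ ≐ t₂ → Γ ⊢ E! t₁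
    AD-≐₂   : ∀ {t₁ t₂} → Γ ⊢ t₁ ≐ t₂ → Γ ⊢ E! t₂
    ιI   : ∀ {F G t} (z : ℕ) → z ∉ namesCtx Γ → z ∉ namesT t →
           z ∉ names F → z ∉ names G →
           Γ ⊢ open₁ F t → Γ ⊢ open₁ G t → Γ ⊢ E! t →
           (open₁ F (fv z) ∷ E! (fv z) ∷ Γ) ⊢ (fv z ≐ t) →
           Γ ⊢ the F G
    ιE¹  : ∀ {F G C} (z : ℕ) → z ∉ namesCtx Γ → z ∉ names C →
           z ∉ names F → z ∉ names G →
           Γ ⊢ the F G →
           (open₁ F (fv z) ∷ open₁ G (fv z) ∷ E! (fv z) ∷ Γ) ⊢ C → Γ ⊢ C
    ιE²  : ∀ {F G t₁ t₂} → Γ ⊢ the F G → Γ ⊢ E! t₁ → Γ ⊢ E! t₂ →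
           Γ ⊢ open₁ F t₁ → Γ ⊢ open₁ F t₂ → Γ ⊢ t₁ ≐ t₂

-- The language and the system INF^{LLΔ}
-- ι-terms occur only in primary positions: flanking = , and as the
-- argument of a Δ-predication.

module LLΔ where

  infixr 4 _⇒_ _⇔_
  infixr 5 _∨'_
  infixr 6 _∧'_
  infix  7 _≐_
  infix  2 _⊢_

  mutual
    data GTerm (n : ℕ) : Set where
      tm : Term n → GTerm n
      ι  : LForm (suc n) → GTerm n

    data LForm (n : ℕ) : Set where
      pred : ℕ → List (Term n) → LForm n
      E!   : Term n → LForm n
      _≐_  : GTerm n → GTerm n → LForm n
      ⊥'   : LForm n
      _∧'_ _∨'_ _⇒_ _⇔_ : LForm n → LForm n → LForm n
      all ex : LForm (suc n) → LForm n
      Δ    : LForm (suc n) → GTerm n → LForm n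

  ¬' : LForm n → LForm n
  ¬' A = A ⇒ ⊥'

  mutual
    renG : (Fin n → Fin m) → GTerm n → GTerm m
    renG ρ (tm t) = tm (renT ρ t)
    renG ρ (ι A)  = ι (renL (liftR ρ) A)

    renL : (Fin n → Fin m) → LForm n → LForm m
    renL ρ (pred P ts) = pred P (map (renT ρ) ts)
    renL ρ (E! t)      = E! (renT ρ t)
    renL ρ (s ≐ t)     = renG ρ s ≐ renG ρ t
    renL ρ ⊥'          = ⊥'
    renL ρ (A ∧' B)    = renL ρ A ∧' renL ρ B
    renL ρ (A ∨' B)    = renL ρ A ∨' renL ρ B
    renL ρ (A ⇒ B)     = renL ρ A ⇒ renL ρ B
    renL ρ (A ⇔ B)     = renL ρ A ⇔ renL ρ B
    renL ρ (all A)     = all (renL (liftR ρ) A)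
    renL ρ (ex A)      = ex (renL (liftR ρ) A)
    renL ρ (Δ B t)     = Δ (renL (liftR ρ) B) (renG ρ t)

  mutual
    subG : (Fin n → Term m) → GTerm n → GTerm m
    subG σ (tm t) = tm (subT σ t)
    subG σ (ι A)  = ι (subL (liftS σ) A)

    subL : (Fin n → Term m) → LForm n → LForm m
    subL σ (pred P ts) = pred P (map (subT σ) ts)
    subL σ (E! t)      = E! (subT σ t)
    subL σ (s ≐ t)     = subG σ s ≐ subG σ t
    subL σ ⊥'          = ⊥'
    subL σ (A ∧' B)    = subL σ A ∧' subL σ B
    subL σ (A ∨' B)    = subL σ A ∨' subL σ B
    subL σ (A ⇒ B)     = subL σ A ⇒ subL σ B
    subL σ (A ⇔ B)     = subL σ A ⇔ subL σ B
    subL σ (all A)     = all (subL (liftS σ) A)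
    subL σ (ex A)      = ex (subL (liftS σ) A)
    subL σ (Δ B t)     = Δ (subL (liftS σ) B) (subG σ t)

  open₁ : LForm (suc n) → Term n → LForm n
  open₁ A t = subL (single t) A

  -- It is undefined
  -- (nothing) when an ι-term would land in a non-primary position
  -- (argument of a predicate letter or of ∃!), since the result would
  -- not be a formula of the language.
  private
    plain : GTerm n → Maybe (Term n)
    plain (tm t) = just t
    plain (ι A)  = nothing

    bind : {A B : Set} → Maybe A → (A → Maybe B) → Maybe B
    bind (just a) f = f a
    bind nothing  f = nothing

    ret : {A : Set} → A → Maybe A
    ret = just

  gliftS : (Fin n → GTerm m) → Fin (suc n) → GTerm (suc m)
  gliftS σ zero    = tm (bv zero)
  gliftS σ (suc i) = renG suc (σ i)

  gsubT : (Fin n → GTerm m) → Term n → Maybe (Term m)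
  gsubT σ (bv i)  = plain (σ i)
  gsubT σ (fv a)  = just (fv a)
  gsubT σ (con c) = just (con c)

  gsubTs : (Fin n → GTerm m) → List (Term n) → Maybe (List (Term m))
  gsubTs σ []       = just []
  gsubTs σ (t ∷ ts) = bind (gsubT σ t) λ t' → bind (gsubTs σ ts) λ ts' → ret (t' ∷ ts')

  mutual
    gsubG : (Fin n → GTerm m) → GTerm n → Maybe (GTerm m)
    gsubG σ (tm (bv i))  = just (σ i)
    gsubG σ (tm (fv a))  = just (tm (fv a))
    gsubG σ (tm (con c)) = just (tm (con c))
    gsubG σ (ι A)        = bind (gsubL (gliftS σ) A) λ A' → ret (ι A')

    gsubL : (Fin n → GTerm m) → LForm n → Maybe (LForm m)
    gsubL σ (pred P ts) = bind (gsubTs σ ts) λ ts' → ret (pred P ts')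
    gsubL σ (E! t)      = bind (gsubT σ t) λ t' → ret (E! t')
    gsubL σ (s ≐ t)     = bind (gsubG σ s) λ s' → bind (gsubG σ t) λ t' → ret (s' ≐ t')
    gsubL σ ⊥'          = just ⊥'
    gsubL σ (A ∧' B)    = bind (gsubL σ A) λ A' → bind (gsubL σ B) λ B' → ret (A' ∧' B')
    gsubL σ (A ∨' B)    = bind (gsubL σ A) λ A' → bind (gsubL σ B) λ B' → ret (A' ∨' B')
    gsubL σ (A ⇒ B)     = bind (gsubL σ A) λ A' → bind (gsubL σ B) λ B' → ret (A' ⇒ B')
    gsubL σ (A ⇔ B)     = bind (gsubL σ A) λ A' → bind (gsubL σ B) λ B' → ret (A' ⇔ B')
    gsubL σ (all A)     = bind (gsubL (gliftS σ) A) λ A' → ret (all A')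
    gsubL σ (ex A)      = bind (gsubL (gliftS σ) A) λ A' → ret (ex A')
    gsubL σ (Δ B t)     = bind (gsubL (gliftS σ) B) λ B' → bind (gsubG σ t) λ t' → ret (Δ B' t')

  gsingle : GTerm n → Fin (suc n) → GTerm n
  gsingle t zero    = t
  gsingle t (suc i) = tm (bv i)

  gopen₁ : LForm (suc n) → GTerm n → Maybe (LForm n)
  gopen₁ A t = gsubL (gsingle t) A

  mutual
    namesG : GTerm n → List ℕ
    namesG (tm t) = namesT t
    namesG (ι A)  = names A

    names : LForm n → List ℕ
    names (pred P ts) = concatMap namesT ts
    names (E! t)      = namesT t
    names (s ≐ t)     = namesG s ++ namesG t
    names ⊥'          = []
    names (A ∧' B)    = names A ++ names B
    names (A ∨' B)    = names A ++ names B
    names (A ⇒ B)     = names A ++ names B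
    names (A ⇔ B)     = names A ++ names B
    names (all A)     = names A
    names (ex A)      = names A
    names (Δ B t)     = names B ++ namesG t

  namesCtx : List (LForm 0) → List ℕ
  namesCtx Γ = concatMap names Γ

  data Atomic {n : ℕ} : LForm n → Set where
    at-pred : ∀ {P ts} → Atomic (pred P ts)
    at-E!   : ∀ {t} → Atomic (E! t)
    at-≐    : ∀ {s t} → Atomic (s ≐ t)

  -- Axiom schemas (A, B are bodies of the binder x, i.e. LForm 1)
  -- Lambert's Law: ∀y (ιxA = y ↔ ∀x (A ↔ x = y))
  lambert : LForm 1 → LForm 0
  lambert A =
    all ((ι (renL inject₁ A) ≐ tm (bv zero))
         ⇔ all (renL inject₁ A ⇔ (tm (bv zero) ≐ tm (bv (suc zero)))))

  Δt-ax : LForm 1 → Term 0 → LForm 0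
  Δt-ax B t = Δ B (tm t) ⇔ (E! t ∧' open₁ B t)

  -- (Δι): Δ x B , ιxA ↔ ∃z (ιxA = z ∧ B^x_z)
  Δι-ax : LForm 1 → LForm 1 → LForm 0
  Δι-ax A B = Δ B (ι A) ⇔ ex ((ι (renL inject₁ A) ≐ tm (bv zero)) ∧' B)

  data _⊢_ (Γ : List (LForm 0)) : LForm 0 → Set where
    ass  : ∀ {A} → A ∈ Γ → Γ ⊢ A
    ∧I   : ∀ {A B} → Γ ⊢ A → Γ ⊢ B → Γ ⊢ A ∧' B
    ∧E₁  : ∀ {A B} → Γ ⊢ A ∧' B → Γ ⊢ A
    ∧E₂  : ∀ {A B} → Γ ⊢ A ∧' B → Γ ⊢ B
    ∨I₁  : ∀ {A B} → Γ ⊢ A → Γ ⊢ A ∨' B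
    ∨I₂  : ∀ {A B} → Γ ⊢ B → Γ ⊢ A ∨' B
    ∨E   : ∀ {A B C} → Γ ⊢ A ∨' B → (A ∷ Γ) ⊢ C → (B ∷ Γ) ⊢ C → Γ ⊢ C
    ⇒I   : ∀ {A B} → (A ∷ Γ) ⊢ B → Γ ⊢ A ⇒ B
    ⇒E   : ∀ {A B} → Γ ⊢ A ⇒ B → Γ ⊢ A → Γ ⊢ B
    ⇔I   : ∀ {A B} → (A ∷ Γ) ⊢ B → (B ∷ Γ) ⊢ A → Γ ⊢ A ⇔ B
    ⇔E₁  : ∀ {A B} → Γ ⊢ A ⇔ B → Γ ⊢ A → Γ ⊢ B
    ⇔E₂  : ∀ {A B} → Γ ⊢ A ⇔ B → Γ ⊢ B → Γ ⊢ A
    ⊥E   : ∀ {A} → Atomic A → Γ ⊢ ⊥' → Γ ⊢ A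
    ∀I   : ∀ {A} (y : ℕ) → y ∉ namesCtx Γ → y ∉ names A →
           (E! (fv y) ∷ Γ) ⊢ open₁ A (fv y) → Γ ⊢ all A
    ∀E   : ∀ {A t} → Γ ⊢ all A → Γ ⊢ E! t → Γ ⊢ open₁ A t
    ∃I   : ∀ {A t} → Γ ⊢ open₁ A t → Γ ⊢ E! t → Γ ⊢ ex A
    ∃E   : ∀ {A C} (y : ℕ) → y ∉ namesCtx Γ → y ∉ names A → y ∉ names C →
           Γ ⊢ ex A → (open₁ A (fv y) ∷ E! (fv y) ∷ Γ) ⊢ C → Γ ⊢ C
    =Iⁿ  : ∀ {t} → Γ ⊢ E! t → Γ ⊢ tm t ≐ tm t
    =E   : ∀ {t₁ t₂ B₁ B₂} (A : LForm 1) → Atomic A →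
           gopen₁ A t₁ ≡ just B₁ → gopen₁ A t₂ ≡ just B₂ →
           Γ ⊢ t₁ ≐ t₂ → Γ ⊢ B₁ → Γ ⊢ B₂
    AD-pred : ∀ {P ts t} → Γ ⊢ pred P ts → t ∈ ts → Γ ⊢ E! t
    AD-E!   : ∀ {t} → Γ ⊢ E! t → Γ ⊢ E! t
    AD-≐₁   : ∀ {t s} → Γ ⊢ tm t ≐ s → Γ ⊢ E! t
    AD-≐₂   : ∀ {t s} → Γ ⊢ s ≐ tm t → Γ ⊢ E! t
    LL   : (A : LForm 1) → Γ ⊢ lambert A
    Δt   : (B : LForm 1) (t : Term 0) → Γ ⊢ Δt-ax B t
    Δι   : (A B : LForm 1) → Γ ⊢ Δι-ax A B

open Iota using (Form) renaming (_≐_ to _≐ᵢ_)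
open LLΔ using (GTerm; LForm; tm; ι) renaming (_≐_ to _≐ₗ_)

τ : LForm n → Form n
τ (LLΔ.pred P ts) = Iota.pred P ts
τ (LLΔ.E! t)      = Iota.E! t
τ (tm s ≐ₗ tm t)  = s ≐ᵢ t
τ (ι A ≐ₗ tm t)   = Iota.the (τ A) (bv zero ≐ᵢ renT suc t)
τ (tm t ≐ₗ ι A)   = Iota.the (τ A) (renT suc t ≐ᵢ bv zero)
τ (ι A ≐ₗ ι B)    =
  Iota.the (τ A) (Iota.the (Iota.renF (liftR suc) (τ B)) (bv (suc zero) ≐ᵢ bv zero))
τ LLΔ.⊥'          = Iota.⊥'
τ (A LLΔ.∧' B)    = τ A Iota.∧' τ B
τ (A LLΔ.∨' B)    = τ A Iota.∨' τ B
τ (A LLΔ.⇒ B)     = τ A Iota.⇒ τ B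
τ (A LLΔ.⇔ B)     = τ A Iota.⇔ τ B
τ (LLΔ.all A)     = Iota.all (τ A)
τ (LLΔ.ex A)      = Iota.ex (τ A)
τ (LLΔ.Δ B (tm t)) = Iota.the (renT suc t ≐ᵢ bv zero) (τ B)
τ (LLΔ.Δ B (ι A))  = Iota.the (τ A) (τ B)

υ : Form n → LForm n
υ (Iota.pred P ts) = LLΔ.pred P ts
υ (Iota.E! t)      = LLΔ.E! t
υ (s ≐ᵢ t)         = tm s ≐ₗ tm t
υ Iota.⊥'          = LLΔ.⊥'
υ (A Iota.∧' B)    = υ A LLΔ.∧' υ B
υ (A Iota.∨' B)    = υ A LLΔ.∨' υ B
υ (A Iota.⇒ B)     = υ A LLΔ.⇒ υ B
υ (A Iota.⇔ B)     = υ A LLΔ.⇔ υ B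
υ (Iota.all A)     = LLΔ.all (υ A)
υ (Iota.ex A)      = LLΔ.ex (υ A)
υ (Iota.the A B)   = LLΔ.Δ (υ B) (ι (υ A))

-- Both translations preserve derivability by induction on derivations: rules shared by the
-- two systems map to themselves and the remaining ones are derived in the target system.
-- In INF^{LLΔ} the ι-rules for υ(ι x[A, B]) = Δ x B, ι x A follow from (Δι) and Lambert's law;
-- ιI also needs substitutivity of identicals inside every υ-image, proved by induction on
-- formulas. In INF^ι, Lambert's law, (Δt), (Δι) and ex falso for arbitrary formulas follow from
-- the ι-rules, and =E for descriptions is reduced to plain terms: τ(t₁ = t₂) yields a plain z
-- denoted by both tᵢ, and τ(A(t)) ↔ τ(A(z)) whenever t denotes z.
-- Derived rules are proved for Γ ⊩ A, derivability from every extension of Γ, which is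
-- monotone by definition; this avoids a weakening lemma for ⊢, whose eigenvariable conditions
-- would require renaming.

module Submission where

open import Defs
open import Data.Nat using (ℕ; zero; suc)
open import Data.Nat.Properties using (1+n≰n)
open import Data.Fin using (Fin; zero; suc; inject₁)
open import Data.List using (List; []; _∷_; _++_; [_]; map; concat)
open import Data.List.Extrema.Nat using (max; xs≤max)
open import Data.List.Membership.Propositional using (_∈_; _∉_)
open import Data.List.Membership.Propositional.Properties using (∈-concat⁺′; ∈-map⁺; ∈-++⁻)
open import Data.List.Properties
  using (++-assoc; ++-identityʳ; map-++; map-∘; map-cong; map-id; concatMap-map; concatMap-cong)
open import Data.List.Relation.Binary.Permutation.Propositional.Properties using (++-comm)
open import Data.List.Relation.Binary.Subset.Propositional using (_⊆_)
open import Data.List.Relation.Binary.Subset.Propositional.Properties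
  using (⊆-refl; ⊆-trans; ⊆-reflexive; ⊆-reflexive-↭; ++⁺)
open import Data.List.Relation.Unary.All as All using (All; []; _∷_)
open import Data.List.Relation.Unary.Any using (here; there)
open import Data.Maybe using (just)
open import Data.Product using (∃; _×_; _,_)
open import Data.Sum using (_⊎_; inj₁; inj₂; [_,_]′)
open import Data.Vec.Functional using (Vector) renaming (_∷_ to _∷ₛ_)
open import Function using (_∘_; id)
open import Relation.Binary.PropositionalEquality hiding ([_])

private
  variable
    n m k l : ℕ

freshFor : (xss : List (List ℕ)) → ∃ λ y → All (y ∉_) xss
freshFor xss = suc (max 0 (concat xss)) , All.tabulate λ xs∈xss y∈xs →
  1+n≰n (All.lookup (xs≤max 0 (concat xss)) (∈-concat⁺′ y∈xs xs∈xss))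

Sub : ℕ → ℕ → Set
Sub n m = Vector (Term m) n

subT-cong : {σ σ′ : Sub n m} → σ ≗ σ′ → subT σ ≗ subT σ′
subT-cong eq (bv i)  = eq i
subT-cong eq (fv a)  = refl
subT-cong eq (con c) = refl

liftS-cong : {σ σ′ : Sub n m} → σ ≗ σ′ → liftS σ ≗ liftS σ′
liftS-cong eq zero    = refl
liftS-cong eq (suc i) = cong (renT suc) (eq i)

subT-id : {σ : Sub n n} → σ ≗ bv → subT σ ≗ id
subT-id eq (bv i)  = eq i
subT-id eq (fv a)  = refl
subT-id eq (con c) = refl

liftS-id : {σ : Sub n n} → σ ≗ bv → liftS σ ≗ bv
liftS-id eq zero    = refl
liftS-id eq (suc i) = cong (renT suc) (eq i)

subT-subT : (θ : Sub m k) (σ : Sub n m) → subT θ ∘ subT σ ≗ subT (subT θ ∘ σ)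
subT-subT θ σ (bv i)  = refl
subT-subT θ σ (fv a)  = refl
subT-subT θ σ (con c) = refl

renT-as-subT : (ρ : Fin n → Fin m) → renT ρ ≗ subT (bv ∘ ρ)
renT-as-subT ρ (bv i)  = refl
renT-as-subT ρ (fv a)  = refl
renT-as-subT ρ (con c) = refl

liftR-as-liftS : (ρ : Fin n → Fin m) → bv ∘ liftR ρ ≗ liftS (bv ∘ ρ)
liftR-as-liftS ρ zero    = refl
liftR-as-liftS ρ (suc i) = refl

subT-liftS-renT-suc : (θ : Sub m k) (t : Term m) → subT (liftS θ) (renT suc t) ≡ renT suc (subT θ t)
subT-liftS-renT-suc θ (bv i)  = refl
subT-liftS-renT-suc θ (fv a)  = refl
subT-liftS-renT-suc θ (con c) = refl

subT-single-renT-suc : (u t : Term n) → subT (single u) (renT suc t) ≡ t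
subT-single-renT-suc u (bv i)  = refl
subT-single-renT-suc u (fv a)  = refl
subT-single-renT-suc u (con c) = refl

liftS-subT : (θ : Sub m k) (σ : Sub n m) → subT (liftS θ) ∘ liftS σ ≗ liftS (subT θ ∘ σ)
liftS-subT θ σ zero    = refl
liftS-subT θ σ (suc i) = subT-liftS-renT-suc θ (σ i)

single-liftS : (u : Term m) (σ : Sub n m) → subT (single u) ∘ liftS σ ≗ u ∷ₛ σ
single-liftS u σ zero    = refl
single-liftS u σ (suc i) = subT-single-renT-suc u (σ i)

hole : (us vs : List (Term n)) → List (Term (suc n))
hole us vs = map (renT suc) us ++ bv zero ∷ map (renT suc) vs

open-hole : (a : Term n) (us vs : List (Term n)) → map (subT (single a)) (hole us vs) ≡ us ++ a ∷ vs
open-hole a us vs = trans (map-++ (subT (single a)) (map (renT suc) us) _)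
  (cong₂ (λ us′ vs′ → us′ ++ a ∷ vs′) (open-weakened us) (open-weakened vs))
  where
  open-weakened : ∀ ts → map (subT (single a)) (map (renT suc) ts) ≡ ts
  open-weakened ts = trans (sym (map-∘ ts)) (trans (map-cong (subT-single-renT-suc a) ts) (map-id ts))

record NaturalDeduction : Set₁ where
  infixr 4 _⇒_ _⇔_
  infixr 5 _∨'_
  infixr 6 _∧'_
  infix  7 _≐_
  infix  2 _⊢_
  field
    Form : ℕ → Set
    _∧'_ _∨'_ _⇒_ _⇔_ : Form 0 → Form 0 → Form 0
    all ex : Form 1 → Form 0
    pred : ℕ → List (Term 0) → Form 0
    E!   : Term 0 → Form 0
    _≐_  : Term 0 → Term 0 → Form 0
    open₁ : Form 1 → Term 0 → Form 0
    names : Form n → List ℕ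
    namesCtx : List (Form 0) → List ℕ
    _⊢_ : List (Form 0) → Form 0 → Set
    ass  : ∀ {Γ A} → A ∈ Γ → Γ ⊢ A
    ∧I   : ∀ {Γ A B} → Γ ⊢ A → Γ ⊢ B → Γ ⊢ A ∧' B
    ∧E₁  : ∀ {Γ A B} → Γ ⊢ A ∧' B → Γ ⊢ A
    ∧E₂  : ∀ {Γ A B} → Γ ⊢ A ∧' B → Γ ⊢ B
    ∨I₁  : ∀ {Γ A B} → Γ ⊢ A → Γ ⊢ A ∨' B
    ∨I₂  : ∀ {Γ A B} → Γ ⊢ B → Γ ⊢ A ∨' B
    ∨E   : ∀ {Γ A B C} → Γ ⊢ A ∨' B → (A ∷ Γ) ⊢ C → (B ∷ Γ) ⊢ C → Γ ⊢ C
    ⇒I   : ∀ {Γ A B} → (A ∷ Γ) ⊢ B → Γ ⊢ A ⇒ B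
    ⇒E   : ∀ {Γ A B} → Γ ⊢ A ⇒ B → Γ ⊢ A → Γ ⊢ B
    ⇔I   : ∀ {Γ A B} → (A ∷ Γ) ⊢ B → (B ∷ Γ) ⊢ A → Γ ⊢ A ⇔ B
    ⇔E₁  : ∀ {Γ A B} → Γ ⊢ A ⇔ B → Γ ⊢ A → Γ ⊢ B
    ⇔E₂  : ∀ {Γ A B} → Γ ⊢ A ⇔ B → Γ ⊢ B → Γ ⊢ A
    ∀I   : ∀ {Γ A} (y : ℕ) → y ∉ namesCtx Γ → y ∉ names A →
           (E! (fv y) ∷ Γ) ⊢ open₁ A (fv y) → Γ ⊢ all A
    ∀E   : ∀ {Γ A t} → Γ ⊢ all A → Γ ⊢ E! t → Γ ⊢ open₁ A t
    ∃I   : ∀ {Γ A t} → Γ ⊢ open₁ A t → Γ ⊢ E! t → Γ ⊢ ex A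
    ∃E   : ∀ {Γ A C} (y : ℕ) → y ∉ namesCtx Γ → y ∉ names A → y ∉ names C →
           Γ ⊢ ex A → (open₁ A (fv y) ∷ E! (fv y) ∷ Γ) ⊢ C → Γ ⊢ C
    =Iⁿ  : ∀ {Γ t} → Γ ⊢ E! t → Γ ⊢ t ≐ t
    AD-≐₁ : ∀ {Γ s t} → Γ ⊢ s ≐ t → Γ ⊢ E! s
    AD-≐₂ : ∀ {Γ s t} → Γ ⊢ s ≐ t → Γ ⊢ E! t
    -- =E only at atomic formulas with one hole, which is all that replacement needs
    =E-pred : ∀ {Γ a b P} us vs → Γ ⊢ a ≐ b → Γ ⊢ pred P (us ++ a ∷ vs) → Γ ⊢ pred P (us ++ b ∷ vs)
    =E-E!   : ∀ {Γ a b} → Γ ⊢ a ≐ b → Γ ⊢ E! a → Γ ⊢ E! b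
    =E-≐ˡ   : ∀ {Γ a b c} → Γ ⊢ a ≐ b → Γ ⊢ a ≐ c → Γ ⊢ b ≐ c
    =E-≐ʳ   : ∀ {Γ a b c} → Γ ⊢ a ≐ b → Γ ⊢ c ≐ a → Γ ⊢ c ≐ b

module Forcing (S : NaturalDeduction) where

  open NaturalDeduction S
    using (Form; _∧'_; _∨'_; _⇒_; _⇔_; all; ex; pred; E!; _≐_; open₁; names; namesCtx; _⊢_)
  private
    module D = NaturalDeduction S

  Ctx : Set
  Ctx = List (Form 0)

  private
    variable
      Γ : Ctx
      A A′ B B′ C : Form 0
      a a′ b b′ : Term 0

  Extensions : Ctx → (Ctx → Set) → Set
  Extensions Γ P = ∀ {Δ} → Γ ⊆ Δ → P Δ

  infixr 1 Extensions
  syntax Extensions Γ (λ Δ → P) = ∀[ Δ ⊇ Γ ] P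

  infix 2 _⊩_
  _⊩_ : Ctx → Form 0 → Set
  Γ ⊩ A = ∀[ Δ ⊇ Γ ] Δ ⊢ A

  ⊩-mono : ∀ {Δ} → Γ ⊆ Δ → Γ ⊩ A → Δ ⊩ A
  ⊩-mono s d s′ = d (⊆-trans s s′)

  ⊩⇒⊢ : Γ ⊩ A → Γ ⊢ A
  ⊩⇒⊢ d = d ⊆-refl

  ⊩-resp-≡ : A ≡ B → Γ ⊩ A → Γ ⊩ B
  ⊩-resp-≡ refl d = d

  private
    hyp : A ∈ Γ → Γ ⊩ A
    hyp p s = D.ass (s p)

  assume : (∀[ Δ ⊇ Γ ] (Δ ⊩ A → Δ ⊩ B)) → ∀[ Δ ⊇ Γ ] (A ∷ Δ ⊢ B)
  assume k s = ⊩⇒⊢ (k (⊆-trans s there) (hyp (here refl)))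

  assume₂ : (∀[ Δ ⊇ Γ ] (Δ ⊩ A → Δ ⊩ B → Δ ⊩ C)) → ∀[ Δ ⊇ Γ ] (A ∷ B ∷ Δ ⊢ C)
  assume₂ k s = ⊩⇒⊢ (k (⊆-trans s (there ∘ there)) (hyp (here refl)) (hyp (there (here refl))))

  assume₃ : ∀ {E} → (∀[ Δ ⊇ Γ ] (Δ ⊩ A → Δ ⊩ B → Δ ⊩ C → Δ ⊩ E)) →
            ∀[ Δ ⊇ Γ ] (A ∷ B ∷ C ∷ Δ ⊢ E)
  assume₃ k s = ⊩⇒⊢ (k (⊆-trans s (there ∘ there ∘ there))
    (hyp (here refl)) (hyp (there (here refl))) (hyp (there (there (here refl)))))

  ∧I : Γ ⊩ A → Γ ⊩ B → Γ ⊩ A ∧' B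
  ∧I d e s = D.∧I (d s) (e s)

  ∧E₁ : Γ ⊩ A ∧' B → Γ ⊩ A
  ∧E₁ d s = D.∧E₁ (d s)

  ∧E₂ : Γ ⊩ A ∧' B → Γ ⊩ B
  ∧E₂ d s = D.∧E₂ (d s)

  ∨I₁ : Γ ⊩ A → Γ ⊩ A ∨' B
  ∨I₁ d s = D.∨I₁ (d s)

  ∨I₂ : Γ ⊩ B → Γ ⊩ A ∨' B
  ∨I₂ d s = D.∨I₂ (d s)

  ∨E : Γ ⊩ A ∨' B → (∀[ Δ ⊇ Γ ] (Δ ⊩ A → Δ ⊩ C)) → (∀[ Δ ⊇ Γ ] (Δ ⊩ B → Δ ⊩ C)) →
       Γ ⊩ C
  ∨E d k l s = D.∨E (d s) (assume k s) (assume l s)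

  ⇒I : (∀[ Δ ⊇ Γ ] (Δ ⊩ A → Δ ⊩ B)) → Γ ⊩ A ⇒ B
  ⇒I k s = D.⇒I (assume k s)

  ⇒E : Γ ⊩ A ⇒ B → Γ ⊩ A → Γ ⊩ B
  ⇒E d e s = D.⇒E (d s) (e s)

  ⇔I : (∀[ Δ ⊇ Γ ] (Δ ⊩ A → Δ ⊩ B)) → (∀[ Δ ⊇ Γ ] (Δ ⊩ B → Δ ⊩ A)) → Γ ⊩ A ⇔ B
  ⇔I k l s = D.⇔I (assume k s) (assume l s)

  ⇔E₁ : Γ ⊩ A ⇔ B → Γ ⊩ A → Γ ⊩ B
  ⇔E₁ d e s = D.⇔E₁ (d s) (e s)

  ⇔E₂ : Γ ⊩ A ⇔ B → Γ ⊩ B → Γ ⊩ A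
  ⇔E₂ d e s = D.⇔E₂ (d s) (e s)

  ∀I : ∀ {F} → (∀[ Δ ⊇ Γ ] ∀ y → Δ ⊩ E! (fv y) → Δ ⊩ open₁ F (fv y)) → Γ ⊩ all F
  ∀I {F = F} k {Δ} s with freshFor (namesCtx Δ ∷ names F ∷ [])
  ... | y , y∉Δ ∷ y∉F ∷ [] = D.∀I y y∉Δ y∉F (assume (λ s′ → k (⊆-trans s s′) y) ⊆-refl)

  ∀E : ∀ {F t} → Γ ⊩ all F → Γ ⊩ E! t → Γ ⊩ open₁ F t
  ∀E d e s = D.∀E (d s) (e s)

  ∃I : ∀ {F t} → Γ ⊩ open₁ F t → Γ ⊩ E! t → Γ ⊩ ex F
  ∃I d e s = D.∃I (d s) (e s)

  ∃E : ∀ {F C} → Γ ⊩ ex F →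
       (∀[ Δ ⊇ Γ ] ∀ y → Δ ⊩ open₁ F (fv y) → Δ ⊩ E! (fv y) → Δ ⊩ C) → Γ ⊩ C
  ∃E {F = F} {C = C} d k {Δ} s with freshFor (namesCtx Δ ∷ names F ∷ names C ∷ [])
  ... | y , y∉Δ ∷ y∉F ∷ y∉C ∷ [] =
    D.∃E y y∉Δ y∉F y∉C (d s) (assume₂ (λ s′ → k (⊆-trans s s′) y) ⊆-refl)

  =Iⁿ : Γ ⊩ E! a → Γ ⊩ a ≐ a
  =Iⁿ d s = D.=Iⁿ (d s)

  AD-≐₁ : Γ ⊩ a ≐ b → Γ ⊩ E! a
  AD-≐₁ d s = D.AD-≐₁ (d s)

  AD-≐₂ : Γ ⊩ a ≐ b → Γ ⊩ E! b
  AD-≐₂ d s = D.AD-≐₂ (d s)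

  ≐-sym : Γ ⊩ a ≐ b → Γ ⊩ b ≐ a
  ≐-sym d s = D.=E-≐ˡ (d s) (D.=Iⁿ (D.AD-≐₁ (d s)))

  ≐-trans : ∀ {c} → Γ ⊩ a ≐ b → Γ ⊩ b ≐ c → Γ ⊩ a ≐ c
  ≐-trans d e s = D.=E-≐ʳ (e s) (d s)

  -- The premises are internalized as implications, so the given derivations are never weakened.
  admissible : ∀ {As} → (∀ {Δ} → All (Δ ⊩_) As → Δ ⊩ B) → All (Γ ⊢_) As → Γ ⊢ B
  admissible f []       = ⊩⇒⊢ (f [])
  admissible f (d ∷ ds) = D.⇒E (admissible (λ ps → ⇒I λ s p → f (p ∷ All.map (⊩-mono s) ps)) ds) d

  ⇔-refl : Γ ⊩ A ⇔ A
  ⇔-refl = ⇔I (λ _ a → a) (λ _ a → a)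

  ⇔-sym : Γ ⊩ A ⇔ B → Γ ⊩ B ⇔ A
  ⇔-sym e = ⇔I (λ s → ⇔E₂ (⊩-mono s e)) (λ s → ⇔E₁ (⊩-mono s e))

  ⇔-trans : Γ ⊩ A ⇔ B → Γ ⊩ B ⇔ C → Γ ⊩ A ⇔ C
  ⇔-trans e f = ⇔I (λ s → ⇔E₁ (⊩-mono s f) ∘ ⇔E₁ (⊩-mono s e))
                   (λ s → ⇔E₂ (⊩-mono s e) ∘ ⇔E₂ (⊩-mono s f))

  ∧-cong : Γ ⊩ A ⇔ A′ → Γ ⊩ B ⇔ B′ → Γ ⊩ A ∧' B ⇔ A′ ∧' B′
  ∧-cong e f = ⇔I (λ s d → ∧I (⇔E₁ (⊩-mono s e) (∧E₁ d)) (⇔E₁ (⊩-mono s f) (∧E₂ d)))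
                  (λ s d → ∧I (⇔E₂ (⊩-mono s e) (∧E₁ d)) (⇔E₂ (⊩-mono s f) (∧E₂ d)))

  ∨-cong : Γ ⊩ A ⇔ A′ → Γ ⊩ B ⇔ B′ → Γ ⊩ A ∨' B ⇔ A′ ∨' B′
  ∨-cong e f = ⇔I (λ s d → ∨E d (λ s′ → ∨I₁ ∘ ⇔E₁ (⊩-mono (⊆-trans s s′) e))
                                (λ s′ → ∨I₂ ∘ ⇔E₁ (⊩-mono (⊆-trans s s′) f)))
                  (λ s d → ∨E d (λ s′ → ∨I₁ ∘ ⇔E₂ (⊩-mono (⊆-trans s s′) e))
                                (λ s′ → ∨I₂ ∘ ⇔E₂ (⊩-mono (⊆-trans s s′) f)))

  ⇒-cong : Γ ⊩ A ⇔ A′ → Γ ⊩ B ⇔ B′ → Γ ⊩ (A ⇒ B) ⇔ (A′ ⇒ B′)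
  ⇒-cong e f = ⇔I (transport e f) (transport (⇔-sym e) (⇔-sym f))
    where
    transport : ∀ {A A′ B B′} → Γ ⊩ A ⇔ A′ → Γ ⊩ B ⇔ B′ →
                ∀[ Δ ⊇ Γ ] (Δ ⊩ A ⇒ B → Δ ⊩ A′ ⇒ B′)
    transport e f s d = ⇒I λ s′ a →
      ⇔E₁ (⊩-mono (⊆-trans s s′) f) (⇒E (⊩-mono s′ d) (⇔E₂ (⊩-mono (⊆-trans s s′) e) a))

  ⇔-cong : Γ ⊩ A ⇔ A′ → Γ ⊩ B ⇔ B′ → Γ ⊩ (A ⇔ B) ⇔ (A′ ⇔ B′)
  ⇔-cong e f = ⇔I (λ s d → ⇔-trans (⇔-sym (⊩-mono s e)) (⇔-trans d (⊩-mono s f)))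
                  (λ s d → ⇔-trans (⊩-mono s e) (⇔-trans d (⇔-sym (⊩-mono s f))))

  Pointwise⇔ : Ctx → Form 1 → Form 1 → Set
  Pointwise⇔ Γ F F′ = ∀[ Δ ⊇ Γ ] ∀ y → Δ ⊩ open₁ F (fv y) ⇔ open₁ F′ (fv y)

  Pointwise⇔-sym : ∀ {F F′} → Pointwise⇔ Γ F F′ → Pointwise⇔ Γ F′ F
  Pointwise⇔-sym e s y = ⇔-sym (e s y)

  all-cong : ∀ {F F′} → Pointwise⇔ Γ F F′ → Γ ⊩ all F ⇔ all F′
  all-cong e = ⇔I (transport e) (transport (Pointwise⇔-sym e))
    where
    transport : ∀ {F F′} → Pointwise⇔ Γ F F′ → ∀[ Δ ⊇ Γ ] (Δ ⊩ all F → Δ ⊩ all F′)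
    transport e s d = ∀I λ s′ y ey → ⇔E₁ (e (⊆-trans s s′) y) (∀E (⊩-mono s′ d) ey)

  ex-cong : ∀ {F F′} → Pointwise⇔ Γ F F′ → Γ ⊩ ex F ⇔ ex F′
  ex-cong e = ⇔I (transport e) (transport (Pointwise⇔-sym e))
    where
    transport : ∀ {F F′} → Pointwise⇔ Γ F F′ → ∀[ Δ ⊇ Γ ] (Δ ⊩ ex F → Δ ⊩ ex F′)
    transport e s d = ∃E d λ s′ y fy ey → ∃I (⇔E₁ (e (⊆-trans s s′) y) fy) ey

  -- Syntactic identity is needed for terms not known to exist, for which a ≐ a is not derivable.
  Identified : Ctx → Term 0 → Term 0 → Set
  Identified Γ a b = a ≡ b ⊎ Γ ⊩ a ≐ b

  Identified-mono : ∀ {Δ} → Γ ⊆ Δ → Identified Γ a b → Identified Δ a b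
  Identified-mono s (inj₁ eq) = inj₁ eq
  Identified-mono s (inj₂ d)  = inj₂ (⊩-mono s d)

  Identified-sym : Identified Γ a b → Identified Γ b a
  Identified-sym (inj₁ eq) = inj₁ (sym eq)
  Identified-sym (inj₂ d)  = inj₂ (≐-sym d)

  infix 4 _≈[_]_
  _≈[_]_ : Sub k 0 → Ctx → Sub k 0 → Set
  σ ≈[ Γ ] σ′ = ∀ i → Identified Γ (σ i) (σ′ i)

  private
    variable
      σ σ′ : Sub k 0

  ≈-mono : ∀ {Δ} → Γ ⊆ Δ → σ ≈[ Γ ] σ′ → σ ≈[ Δ ] σ′
  ≈-mono s h = Identified-mono s ∘ h

  ≈-sym : σ ≈[ Γ ] σ′ → σ′ ≈[ Γ ] σ
  ≈-sym h = Identified-sym ∘ h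

  ∷ₛ-≈ : Identified Γ a b → σ ≈[ Γ ] σ′ → (a ∷ₛ σ) ≈[ Γ ] (b ∷ₛ σ′)
  ∷ₛ-≈ ab h zero    = ab
  ∷ₛ-≈ ab h (suc i) = h i

  single-≈ : Γ ⊩ a ≐ b → single a ≈[ Γ ] single b
  single-≈ e zero = inj₂ e

  subT-≈ : σ ≈[ Γ ] σ′ → ∀ t → Identified Γ (subT σ t) (subT σ′ t)
  subT-≈ h (bv i)  = h i
  subT-≈ h (fv x)  = inj₁ refl
  subT-≈ h (con c) = inj₁ refl

  E!-resp : Identified Γ a b → Γ ⊩ E! a → Γ ⊩ E! b
  E!-resp (inj₁ refl) d = d
  E!-resp (inj₂ e)    d s = D.=E-E! (e s) (d s)

  ≐-resp : Identified Γ a a′ → Identified Γ b b′ → Γ ⊩ a ≐ b → Γ ⊩ a′ ≐ b′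
  ≐-resp aa′ bb′ = resp-right bb′ ∘ resp-left aa′
    where
    resp-left : ∀ {a a′ b} → Identified Γ a a′ → Γ ⊩ a ≐ b → Γ ⊩ a′ ≐ b
    resp-left (inj₁ refl) d = d
    resp-left (inj₂ e)    d s = D.=E-≐ˡ (e s) (d s)
    resp-right : ∀ {a b b′} → Identified Γ b b′ → Γ ⊩ a ≐ b → Γ ⊩ a ≐ b′
    resp-right (inj₁ refl) d = d
    resp-right (inj₂ e)    d s = D.=E-≐ʳ (e s) (d s)

  pred-resp : ∀ {P} {f g : Term k → Term 0} → (∀ t → Identified Γ (f t) (g t)) →
              ∀ us ts → Γ ⊩ pred P (us ++ map f ts) → Γ ⊩ pred P (us ++ map g ts)
  pred-resp h us []       d = d
  pred-resp {P = P} {f} {g} h us (t ∷ ts) d =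
    subst (λ vs → _ ⊩ pred P vs) (++-assoc us [ g t ] _)
      (pred-resp h (us ++ [ g t ]) ts
        (subst (λ vs → _ ⊩ pred P vs) (sym (++-assoc us [ g t ] _)) (resp-at (h t) d)))
    where
    resp-at : ∀ {a b vs} → Identified Γ a b → Γ ⊩ pred P (us ++ a ∷ vs) → Γ ⊩ pred P (us ++ b ∷ vs)
    resp-at (inj₁ refl) d = d
    resp-at (inj₂ e)    d s = D.=E-pred us _ (e s) (d s)

  ≈-cong : (F : Sub k 0 → Form 0) → (∀ {Δ σ σ′} → σ ≈[ Δ ] σ′ → Δ ⊩ F σ → Δ ⊩ F σ′) →
           σ ≈[ Γ ] σ′ → Γ ⊩ F σ ⇔ F σ′
  ≈-cong F resp h = ⇔I (λ s → resp (≈-mono s h)) (λ s → resp (≈-sym (≈-mono s h)))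

  pred-cong : ∀ {P} ts → σ ≈[ Γ ] σ′ → Γ ⊩ pred P (map (subT σ) ts) ⇔ pred P (map (subT σ′) ts)
  pred-cong {P = P} ts = ≈-cong (λ σ → pred P (map (subT σ) ts)) (λ h → pred-resp (subT-≈ h) [] ts)

  E!-cong : ∀ t → σ ≈[ Γ ] σ′ → Γ ⊩ E! (subT σ t) ⇔ E! (subT σ′ t)
  E!-cong t = ≈-cong (λ σ → E! (subT σ t)) (λ h → E!-resp (subT-≈ h t))

  ≐-cong : ∀ t u → σ ≈[ Γ ] σ′ → Γ ⊩ subT σ t ≐ subT σ u ⇔ subT σ′ t ≐ subT σ′ u
  ≐-cong t u = ≈-cong (λ σ → subT σ t ≐ subT σ u) (λ h → ≐-resp (subT-≈ h t) (subT-≈ h u))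

namesT-renT : (ρ : Fin n → Fin m) → namesT ∘ renT ρ ≗ namesT
namesT-renT ρ (bv i)  = refl
namesT-renT ρ (fv a)  = refl
namesT-renT ρ (con c) = refl

module IotaSubstitution where

  open Iota

  subF-cong : {σ σ′ : Sub n m} → σ ≗ σ′ → subF σ ≗ subF σ′
  subF-cong eq (pred P ts) = cong (pred P) (map-cong (subT-cong eq) ts)
  subF-cong eq (E! t)      = cong E! (subT-cong eq t)
  subF-cong eq (s ≐ t)     = cong₂ _≐_ (subT-cong eq s) (subT-cong eq t)
  subF-cong eq ⊥'          = refl
  subF-cong eq (A ∧' B)    = cong₂ _∧'_ (subF-cong eq A) (subF-cong eq B)
  subF-cong eq (A ∨' B)    = cong₂ _∨'_ (subF-cong eq A) (subF-cong eq B)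
  subF-cong eq (A ⇒ B)     = cong₂ _⇒_ (subF-cong eq A) (subF-cong eq B)
  subF-cong eq (A ⇔ B)     = cong₂ _⇔_ (subF-cong eq A) (subF-cong eq B)
  subF-cong eq (all A)     = cong all (subF-cong (liftS-cong eq) A)
  subF-cong eq (ex A)      = cong ex (subF-cong (liftS-cong eq) A)
  subF-cong eq (the F G)   = cong₂ the (subF-cong (liftS-cong eq) F) (subF-cong (liftS-cong eq) G)

  subF-subF : (θ : Sub m k) (σ : Sub n m) → subF θ ∘ subF σ ≗ subF (subT θ ∘ σ)
  subF-subF-liftS : (θ : Sub m k) (σ : Sub n m) → subF (liftS θ) ∘ subF (liftS σ) ≗ subF (liftS (subT θ ∘ σ))

  subF-subF θ σ (pred P ts) = cong (pred P) (trans (sym (map-∘ ts)) (map-cong (subT-subT θ σ) ts))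
  subF-subF θ σ (E! t)      = cong E! (subT-subT θ σ t)
  subF-subF θ σ (s ≐ t)     = cong₂ _≐_ (subT-subT θ σ s) (subT-subT θ σ t)
  subF-subF θ σ ⊥'          = refl
  subF-subF θ σ (A ∧' B)    = cong₂ _∧'_ (subF-subF θ σ A) (subF-subF θ σ B)
  subF-subF θ σ (A ∨' B)    = cong₂ _∨'_ (subF-subF θ σ A) (subF-subF θ σ B)
  subF-subF θ σ (A ⇒ B)     = cong₂ _⇒_ (subF-subF θ σ A) (subF-subF θ σ B)
  subF-subF θ σ (A ⇔ B)     = cong₂ _⇔_ (subF-subF θ σ A) (subF-subF θ σ B)
  subF-subF θ σ (all A)     = cong all (subF-subF-liftS θ σ A)
  subF-subF θ σ (ex A)      = cong ex (subF-subF-liftS θ σ A)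
  subF-subF θ σ (the F G)   = cong₂ the (subF-subF-liftS θ σ F) (subF-subF-liftS θ σ G)

  subF-subF-liftS θ σ A = trans (subF-subF (liftS θ) (liftS σ) A) (subF-cong (liftS-subT θ σ) A)

  renF-as-subF : (ρ : Fin n → Fin m) → renF ρ ≗ subF (bv ∘ ρ)
  renF-as-subF-liftR : (ρ : Fin n → Fin m) → renF (liftR ρ) ≗ subF (liftS (bv ∘ ρ))

  renF-as-subF ρ (pred P ts) = cong (pred P) (map-cong (renT-as-subT ρ) ts)
  renF-as-subF ρ (E! t)      = cong E! (renT-as-subT ρ t)
  renF-as-subF ρ (s ≐ t)     = cong₂ _≐_ (renT-as-subT ρ s) (renT-as-subT ρ t)
  renF-as-subF ρ ⊥'          = refl
  renF-as-subF ρ (A ∧' B)    = cong₂ _∧'_ (renF-as-subF ρ A) (renF-as-subF ρ B)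
  renF-as-subF ρ (A ∨' B)    = cong₂ _∨'_ (renF-as-subF ρ A) (renF-as-subF ρ B)
  renF-as-subF ρ (A ⇒ B)     = cong₂ _⇒_ (renF-as-subF ρ A) (renF-as-subF ρ B)
  renF-as-subF ρ (A ⇔ B)     = cong₂ _⇔_ (renF-as-subF ρ A) (renF-as-subF ρ B)
  renF-as-subF ρ (all A)     = cong all (renF-as-subF-liftR ρ A)
  renF-as-subF ρ (ex A)      = cong ex (renF-as-subF-liftR ρ A)
  renF-as-subF ρ (the F G)   = cong₂ the (renF-as-subF-liftR ρ F) (renF-as-subF-liftR ρ G)

  renF-as-subF-liftR ρ A = trans (renF-as-subF (liftR ρ) A) (subF-cong (liftR-as-liftS ρ) A)

  subF-id : {σ : Sub n n} → σ ≗ bv → subF σ ≗ id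
  subF-id eq (pred P ts) = cong (pred P) (trans (map-cong (subT-id eq) ts) (map-id ts))
  subF-id eq (E! t)      = cong E! (subT-id eq t)
  subF-id eq (s ≐ t)     = cong₂ _≐_ (subT-id eq s) (subT-id eq t)
  subF-id eq ⊥'          = refl
  subF-id eq (A ∧' B)    = cong₂ _∧'_ (subF-id eq A) (subF-id eq B)
  subF-id eq (A ∨' B)    = cong₂ _∨'_ (subF-id eq A) (subF-id eq B)
  subF-id eq (A ⇒ B)     = cong₂ _⇒_ (subF-id eq A) (subF-id eq B)
  subF-id eq (A ⇔ B)     = cong₂ _⇔_ (subF-id eq A) (subF-id eq B)
  subF-id eq (all A)     = cong all (subF-id (liftS-id eq) A)
  subF-id eq (ex A)      = cong ex (subF-id (liftS-id eq) A)
  subF-id eq (the F G)   = cong₂ the (subF-id (liftS-id eq) F) (subF-id (liftS-id eq) G)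

  names-renF : (ρ : Fin n → Fin m) (A : Form n) → names (renF ρ A) ≡ names A
  names-renF ρ (pred P ts) = trans (concatMap-map namesT (renT ρ) ts) (concatMap-cong (namesT-renT ρ) ts)
  names-renF ρ (E! t)      = namesT-renT ρ t
  names-renF ρ (s ≐ t)     = cong₂ _++_ (namesT-renT ρ s) (namesT-renT ρ t)
  names-renF ρ ⊥'          = refl
  names-renF ρ (A ∧' B)    = cong₂ _++_ (names-renF ρ A) (names-renF ρ B)
  names-renF ρ (A ∨' B)    = cong₂ _++_ (names-renF ρ A) (names-renF ρ B)
  names-renF ρ (A ⇒ B)     = cong₂ _++_ (names-renF ρ A) (names-renF ρ B)
  names-renF ρ (A ⇔ B)     = cong₂ _++_ (names-renF ρ A) (names-renF ρ B)
  names-renF ρ (all A)     = names-renF (liftR ρ) A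
  names-renF ρ (ex A)      = names-renF (liftR ρ) A
  names-renF ρ (the F G)   = cong₂ _++_ (names-renF (liftR ρ) F) (names-renF (liftR ρ) G)

  open₁-subF-liftS : (σ : Sub n m) (u : Term m) (A : Form (suc n)) →
                     open₁ (subF (liftS σ) A) u ≡ subF (u ∷ₛ σ) A
  open₁-subF-liftS σ u A = trans (subF-subF (single u) (liftS σ) A) (subF-cong (single-liftS u σ) A)

  subF-renF-inverse : (θ : Sub m n) (ρ : Fin n → Fin m) → θ ∘ ρ ≗ bv → (A : Form n) → subF θ (renF ρ A) ≡ A
  subF-renF-inverse θ ρ inv A =
    trans (cong (subF θ) (renF-as-subF ρ A)) (trans (subF-subF θ (bv ∘ ρ) A) (subF-id inv A))

  subF-liftS-single-inject₁ : (u : Term 0) (A : Form 1) → subF (liftS (single u)) (renF inject₁ A) ≡ A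
  subF-liftS-single-inject₁ u = subF-renF-inverse (liftS (single u)) inject₁ λ { zero → refl }

module IotaDeduction where

  open Iota
  open IotaSubstitution

  private
    variable
      Γ : List (Form 0)
      a b : Term 0

  =E-at : ∀ {B₁ B₂} (A : Form 1) → Atomic A → open₁ A a ≡ B₁ → open₁ A b ≡ B₂ →
          Γ ⊢ a ≐ b → Γ ⊢ B₁ → Γ ⊢ B₂
  =E-at A at refl refl = =E A at

  =E-pred : ∀ {P} us vs → Γ ⊢ a ≐ b → Γ ⊢ pred P (us ++ a ∷ vs) → Γ ⊢ pred P (us ++ b ∷ vs)
  =E-pred {a = a} {b} {P} us vs =
    =E-at (pred P (hole us vs)) at-pred (cong (pred P) (open-hole a us vs)) (cong (pred P) (open-hole b us vs))

  =E-≐ˡ : ∀ {c} → Γ ⊢ a ≐ b → Γ ⊢ a ≐ c → Γ ⊢ b ≐ c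
  =E-≐ˡ {a = a} {b} {c} =
    =E-at (bv zero ≐ renT suc c) at-≐ (cong (a ≐_) (subT-single-renT-suc a c)) (cong (b ≐_) (subT-single-renT-suc b c))

  =E-≐ʳ : ∀ {c} → Γ ⊢ a ≐ b → Γ ⊢ c ≐ a → Γ ⊢ c ≐ b
  =E-≐ʳ {a = a} {b} {c} =
    =E-at (renT suc c ≐ bv zero) at-≐ (cong (_≐ a) (subT-single-renT-suc a c)) (cong (_≐ b) (subT-single-renT-suc b c))

  INFι : NaturalDeduction
  INFι = record
    { Iota
    ; =E-pred = =E-pred
    ; =E-E!   = =E (E! (bv zero)) at-E!
    ; =E-≐ˡ   = =E-≐ˡ
    ; =E-≐ʳ   = =E-≐ʳ
    }

module IotaForcing where

  open Iota using (Form; pred; E!; _≐_; ⊥'; _∧'_; _∨'_; _⇒_; _⇔_; all; ex; the; subF; open₁; names; namesCtx;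
                   at-pred; at-E!; at-≐)
  open IotaSubstitution
  open IotaDeduction using (INFι)
  open Forcing INFι public

  private
    variable
      Γ : Ctx
      a b : Term 0
      C : Form 0
      F F′ G G′ : Form 1

  ιI : ∀ {t} → Γ ⊩ open₁ F t → Γ ⊩ open₁ G t → Γ ⊩ E! t →
       (∀[ Δ ⊇ Γ ] ∀ y → Δ ⊩ open₁ F (fv y) → Δ ⊩ E! (fv y) → Δ ⊩ fv y ≐ t) → Γ ⊩ the F G
  ιI {F = F} {G} {t} f g e k {Δ} s with freshFor (namesCtx Δ ∷ namesT t ∷ names F ∷ names G ∷ [])
  ... | y , y∉Δ ∷ y∉t ∷ y∉F ∷ y∉G ∷ [] =
    Iota.ιI y y∉Δ y∉t y∉F y∉G (f s) (g s) (e s) (assume₂ (λ s′ → k (⊆-trans s s′) y) ⊆-refl)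

  ιE¹ : Γ ⊩ the F G →
        (∀[ Δ ⊇ Γ ] ∀ y → Δ ⊩ open₁ F (fv y) → Δ ⊩ open₁ G (fv y) → Δ ⊩ E! (fv y) → Δ ⊩ C) →
        Γ ⊩ C
  ιE¹ {F = F} {G} {C} d k {Δ} s with freshFor (namesCtx Δ ∷ names C ∷ names F ∷ names G ∷ [])
  ... | y , y∉Δ ∷ y∉C ∷ y∉F ∷ y∉G ∷ [] =
    Iota.ιE¹ y y∉Δ y∉C y∉F y∉G (d s) (assume₃ (λ s′ → k (⊆-trans s s′) y) ⊆-refl)

  ιE² : Γ ⊩ the F G → Γ ⊩ E! a → Γ ⊩ E! b → Γ ⊩ open₁ F a → Γ ⊩ open₁ F b → Γ ⊩ a ≐ b
  ιE² d ea eb fa fb s = Iota.ιE² (d s) (ea s) (eb s) (fa s) (fb s)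

  the-mono : Pointwise⇔ Γ F F′ →
             (∀[ Δ ⊇ Γ ] ∀ y → Δ ⊩ open₁ F (fv y) → Δ ⊩ open₁ G (fv y) → Δ ⊩ open₁ G′ (fv y)) →
             Γ ⊩ the F G → Γ ⊩ the F′ G′
  the-mono eF eG d = ιE¹ d λ s y fy gy ey →
    ιI (⇔E₁ (eF s y) fy) (eG s y fy gy) ey λ s′ w f′w ew →
      ιE² (⊩-mono (⊆-trans s s′) d) ew (⊩-mono s′ ey) (⇔E₂ (eF (⊆-trans s s′) w) f′w) (⊩-mono s′ fy)

  the-cong : Pointwise⇔ Γ F F′ → Pointwise⇔ Γ G G′ → Γ ⊩ the F G ⇔ the F′ G′
  the-cong eF eG =
    ⇔I (λ s → the-mono (λ s′ → eF (⊆-trans s s′)) (λ s′ y _ → ⇔E₁ (eG (⊆-trans s s′) y)))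
       (λ s → the-mono (λ s′ → Pointwise⇔-sym eF (⊆-trans s s′))
                       (λ s′ y _ → ⇔E₂ (eG (⊆-trans s s′) y)))

  replace : (X : Form k) {σ σ′ : Sub k 0} → σ ≈[ Γ ] σ′ → Γ ⊩ subF σ X ⇔ subF σ′ X
  replace-body : (X : Form (suc k)) {σ σ′ : Sub k 0} → σ ≈[ Γ ] σ′ →
                 Pointwise⇔ Γ (subF (liftS σ) X) (subF (liftS σ′) X)

  replace (pred P ts) h = pred-cong ts h
  replace (E! t)      h = E!-cong t h
  replace (s ≐ t)     h = ≐-cong s t h
  replace ⊥'          h = ⇔-refl
  replace (A ∧' B)    h = ∧-cong (replace A h) (replace B h)
  replace (A ∨' B)    h = ∨-cong (replace A h) (replace B h)
  replace (A ⇒ B)     h = ⇒-cong (replace A h) (replace B h)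
  replace (A ⇔ B)     h = ⇔-cong (replace A h) (replace B h)
  replace (all A)     h = all-cong (replace-body A h)
  replace (ex A)      h = ex-cong (replace-body A h)
  replace (the F G)   h = the-cong (replace-body F h) (replace-body G h)

  replace-body X {σ} {σ′} h s y =
    ⊩-resp-≡ (sym (cong₂ _⇔_ (open₁-subF-liftS σ (fv y) X) (open₁-subF-liftS σ′ (fv y) X)))
      (replace X (∷ₛ-≈ (inj₁ refl) (≈-mono s h)))

  replace₁ : (F : Form 1) → Γ ⊩ a ≐ b → Γ ⊩ open₁ F a → Γ ⊩ open₁ F b
  replace₁ F e = ⇔E₁ (replace F (single-≈ e))

  ⊥E : ∀ {A} → Iota.Atomic A → Γ ⊩ ⊥' → Γ ⊩ A
  ⊥E at d s = Iota.⊥E at (d s)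

  ex-falso : (X : Form k) (σ : Sub k 0) → Γ ⊩ ⊥' → Γ ⊩ subF σ X
  ex-falso-body : (X : Form (suc k)) (σ : Sub k 0) (u : Term 0) → Γ ⊩ ⊥' → Γ ⊩ open₁ (subF (liftS σ) X) u

  ex-falso (pred P ts) σ d = ⊥E at-pred d
  ex-falso (E! t)      σ d = ⊥E at-E! d
  ex-falso (s ≐ t)     σ d = ⊥E at-≐ d
  ex-falso ⊥'          σ d = d
  ex-falso (A ∧' B)    σ d = ∧I (ex-falso A σ d) (ex-falso B σ d)
  ex-falso (A ∨' B)    σ d = ∨I₁ (ex-falso A σ d)
  ex-falso (A ⇒ B)     σ d = ⇒I λ s _ → ex-falso B σ (⊩-mono s d)
  ex-falso (A ⇔ B)     σ d = ⇔I (λ s _ → ex-falso B σ (⊩-mono s d)) (λ s _ → ex-falso A σ (⊩-mono s d))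
  ex-falso (all A)     σ d = ∀I λ s y _ → ex-falso-body A σ (fv y) (⊩-mono s d)
  ex-falso (ex A)      σ d = ∃I (ex-falso-body A σ (con 0) d) (⊥E at-E! d)
  ex-falso (the F G)   σ d =
    ιI (ex-falso-body F σ (con 0) d) (ex-falso-body G σ (con 0) d) (⊥E at-E! d) λ s _ _ _ → ⊥E at-≐ (⊩-mono s d)

  ex-falso-body X σ u d = ⊩-resp-≡ (sym (open₁-subF-liftS σ u X)) (ex-falso X (u ∷ₛ σ) d)

module LLΔSubstitution where

  open LLΔ

  subG-cong : {σ σ′ : Sub n m} → σ ≗ σ′ → subG σ ≗ subG σ′
  subL-cong : {σ σ′ : Sub n m} → σ ≗ σ′ → subL σ ≗ subL σ′

  subG-cong eq (tm t) = cong tm (subT-cong eq t)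
  subG-cong eq (ι A)  = cong ι (subL-cong (liftS-cong eq) A)

  subL-cong eq (pred P ts) = cong (pred P) (map-cong (subT-cong eq) ts)
  subL-cong eq (E! t)      = cong E! (subT-cong eq t)
  subL-cong eq (s ≐ t)     = cong₂ _≐_ (subG-cong eq s) (subG-cong eq t)
  subL-cong eq ⊥'          = refl
  subL-cong eq (A ∧' B)    = cong₂ _∧'_ (subL-cong eq A) (subL-cong eq B)
  subL-cong eq (A ∨' B)    = cong₂ _∨'_ (subL-cong eq A) (subL-cong eq B)
  subL-cong eq (A ⇒ B)     = cong₂ _⇒_ (subL-cong eq A) (subL-cong eq B)
  subL-cong eq (A ⇔ B)     = cong₂ _⇔_ (subL-cong eq A) (subL-cong eq B)
  subL-cong eq (all A)     = cong all (subL-cong (liftS-cong eq) A)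
  subL-cong eq (ex A)      = cong ex (subL-cong (liftS-cong eq) A)
  subL-cong eq (Δ B t)     = cong₂ Δ (subL-cong (liftS-cong eq) B) (subG-cong eq t)

  subG-subG : (θ : Sub m k) (σ : Sub n m) → subG θ ∘ subG σ ≗ subG (subT θ ∘ σ)
  subL-subL : (θ : Sub m k) (σ : Sub n m) → subL θ ∘ subL σ ≗ subL (subT θ ∘ σ)
  subL-subL-liftS : (θ : Sub m k) (σ : Sub n m) → subL (liftS θ) ∘ subL (liftS σ) ≗ subL (liftS (subT θ ∘ σ))

  subG-subG θ σ (tm t) = cong tm (subT-subT θ σ t)
  subG-subG θ σ (ι A)  = cong ι (subL-subL-liftS θ σ A)

  subL-subL θ σ (pred P ts) = cong (pred P) (trans (sym (map-∘ ts)) (map-cong (subT-subT θ σ) ts))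
  subL-subL θ σ (E! t)      = cong E! (subT-subT θ σ t)
  subL-subL θ σ (s ≐ t)     = cong₂ _≐_ (subG-subG θ σ s) (subG-subG θ σ t)
  subL-subL θ σ ⊥'          = refl
  subL-subL θ σ (A ∧' B)    = cong₂ _∧'_ (subL-subL θ σ A) (subL-subL θ σ B)
  subL-subL θ σ (A ∨' B)    = cong₂ _∨'_ (subL-subL θ σ A) (subL-subL θ σ B)
  subL-subL θ σ (A ⇒ B)     = cong₂ _⇒_ (subL-subL θ σ A) (subL-subL θ σ B)
  subL-subL θ σ (A ⇔ B)     = cong₂ _⇔_ (subL-subL θ σ A) (subL-subL θ σ B)
  subL-subL θ σ (all A)     = cong all (subL-subL-liftS θ σ A)
  subL-subL θ σ (ex A)      = cong ex (subL-subL-liftS θ σ A)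
  subL-subL θ σ (Δ B t)     = cong₂ Δ (subL-subL-liftS θ σ B) (subG-subG θ σ t)

  subL-subL-liftS θ σ A = trans (subL-subL (liftS θ) (liftS σ) A) (subL-cong (liftS-subT θ σ) A)

  renG-as-subG : (ρ : Fin n → Fin m) → renG ρ ≗ subG (bv ∘ ρ)
  renL-as-subL : (ρ : Fin n → Fin m) → renL ρ ≗ subL (bv ∘ ρ)
  renL-as-subL-liftR : (ρ : Fin n → Fin m) → renL (liftR ρ) ≗ subL (liftS (bv ∘ ρ))

  renG-as-subG ρ (tm t) = cong tm (renT-as-subT ρ t)
  renG-as-subG ρ (ι A)  = cong ι (renL-as-subL-liftR ρ A)

  renL-as-subL ρ (pred P ts) = cong (pred P) (map-cong (renT-as-subT ρ) ts)
  renL-as-subL ρ (E! t)      = cong E! (renT-as-subT ρ t)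
  renL-as-subL ρ (s ≐ t)     = cong₂ _≐_ (renG-as-subG ρ s) (renG-as-subG ρ t)
  renL-as-subL ρ ⊥'          = refl
  renL-as-subL ρ (A ∧' B)    = cong₂ _∧'_ (renL-as-subL ρ A) (renL-as-subL ρ B)
  renL-as-subL ρ (A ∨' B)    = cong₂ _∨'_ (renL-as-subL ρ A) (renL-as-subL ρ B)
  renL-as-subL ρ (A ⇒ B)     = cong₂ _⇒_ (renL-as-subL ρ A) (renL-as-subL ρ B)
  renL-as-subL ρ (A ⇔ B)     = cong₂ _⇔_ (renL-as-subL ρ A) (renL-as-subL ρ B)
  renL-as-subL ρ (all A)     = cong all (renL-as-subL-liftR ρ A)
  renL-as-subL ρ (ex A)      = cong ex (renL-as-subL-liftR ρ A)
  renL-as-subL ρ (Δ B t)     = cong₂ Δ (renL-as-subL-liftR ρ B) (renG-as-subG ρ t)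

  renL-as-subL-liftR ρ A = trans (renL-as-subL (liftR ρ) A) (subL-cong (liftR-as-liftS ρ) A)

  subG-id : {σ : Sub n n} → σ ≗ bv → subG σ ≗ id
  subL-id : {σ : Sub n n} → σ ≗ bv → subL σ ≗ id

  subG-id eq (tm t) = cong tm (subT-id eq t)
  subG-id eq (ι A)  = cong ι (subL-id (liftS-id eq) A)

  subL-id eq (pred P ts) = cong (pred P) (trans (map-cong (subT-id eq) ts) (map-id ts))
  subL-id eq (E! t)      = cong E! (subT-id eq t)
  subL-id eq (s ≐ t)     = cong₂ _≐_ (subG-id eq s) (subG-id eq t)
  subL-id eq ⊥'          = refl
  subL-id eq (A ∧' B)    = cong₂ _∧'_ (subL-id eq A) (subL-id eq B)
  subL-id eq (A ∨' B)    = cong₂ _∨'_ (subL-id eq A) (subL-id eq B)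
  subL-id eq (A ⇒ B)     = cong₂ _⇒_ (subL-id eq A) (subL-id eq B)
  subL-id eq (A ⇔ B)     = cong₂ _⇔_ (subL-id eq A) (subL-id eq B)
  subL-id eq (all A)     = cong all (subL-id (liftS-id eq) A)
  subL-id eq (ex A)      = cong ex (subL-id (liftS-id eq) A)
  subL-id eq (Δ B t)     = cong₂ Δ (subL-id (liftS-id eq) B) (subG-id eq t)

  namesG-renG : (ρ : Fin n → Fin m) (g : GTerm n) → namesG (renG ρ g) ≡ namesG g
  names-renL : (ρ : Fin n → Fin m) (A : LForm n) → names (renL ρ A) ≡ names A

  namesG-renG ρ (tm t) = namesT-renT ρ t
  namesG-renG ρ (ι A)  = names-renL (liftR ρ) A

  names-renL ρ (pred P ts) = trans (concatMap-map namesT (renT ρ) ts) (concatMap-cong (namesT-renT ρ) ts)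
  names-renL ρ (E! t)      = namesT-renT ρ t
  names-renL ρ (s ≐ t)     = cong₂ _++_ (namesG-renG ρ s) (namesG-renG ρ t)
  names-renL ρ ⊥'          = refl
  names-renL ρ (A ∧' B)    = cong₂ _++_ (names-renL ρ A) (names-renL ρ B)
  names-renL ρ (A ∨' B)    = cong₂ _++_ (names-renL ρ A) (names-renL ρ B)
  names-renL ρ (A ⇒ B)     = cong₂ _++_ (names-renL ρ A) (names-renL ρ B)
  names-renL ρ (A ⇔ B)     = cong₂ _++_ (names-renL ρ A) (names-renL ρ B)
  names-renL ρ (all A)     = names-renL (liftR ρ) A
  names-renL ρ (ex A)      = names-renL (liftR ρ) A
  names-renL ρ (Δ B t)     = cong₂ _++_ (names-renL (liftR ρ) B) (namesG-renG ρ t)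

  open₁-subL-liftS : (σ : Sub n m) (u : Term m) (A : LForm (suc n)) →
                     open₁ (subL (liftS σ) A) u ≡ subL (u ∷ₛ σ) A
  open₁-subL-liftS σ u A = trans (subL-subL (single u) (liftS σ) A) (subL-cong (single-liftS u σ) A)

  subL-renL-inverse : (θ : Sub m n) (ρ : Fin n → Fin m) → θ ∘ ρ ≗ bv → (A : LForm n) → subL θ (renL ρ A) ≡ A
  subL-renL-inverse θ ρ inv A =
    trans (cong (subL θ) (renL-as-subL ρ A)) (trans (subL-subL θ (bv ∘ ρ) A) (subL-id inv A))

  subG-renG-suc : (θ : Sub m k) (g : GTerm m) → subG (liftS θ) (renG suc g) ≡ renG suc (subG θ g)
  subG-renG-suc θ g =
    trans (cong (subG (liftS θ)) (renG-as-subG suc g))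
      (trans (subG-subG (liftS θ) (bv ∘ suc) g)
        (sym (trans (renG-as-subG suc (subG θ g))
          (trans (subG-subG (bv ∘ suc) θ g) (subG-cong (sym ∘ renT-as-subT suc ∘ θ) g)))))

  subG-single-renG-suc : (u : Term n) (g : GTerm n) → subG (single u) (renG suc g) ≡ g
  subG-single-renG-suc u g =
    trans (cong (subG (single u)) (renG-as-subG suc g))
      (trans (subG-subG (single u) (bv ∘ suc) g) (subG-id (λ _ → refl) g))

  subL-liftS-single-inject₁ : (u : Term 0) (A : LForm 1) → subL (liftS (single u)) (renL inject₁ A) ≡ A
  subL-liftS-single-inject₁ u = subL-renL-inverse (liftS (single u)) inject₁ λ { zero → refl }

module GeneralSubstitution where

  open LLΔ
  open LLΔSubstitution

  GSub : ℕ → ℕ → Set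
  GSub n m = Vector (GTerm m) n

  private
    variable
      γ : GSub n m

  gliftS-plain : {σ : Sub n m} → (∀ i → γ i ≡ tm (σ i)) → ∀ i → gliftS γ i ≡ tm (liftS σ i)
  gliftS-plain eq zero    = refl
  gliftS-plain eq (suc i) = cong (renG suc) (eq i)

  gsubT-plain : {σ : Sub n m} → (∀ i → γ i ≡ tm (σ i)) → ∀ t → gsubT γ t ≡ just (subT σ t)
  gsubT-plain eq (bv i) rewrite eq i = refl
  gsubT-plain eq (fv a)  = refl
  gsubT-plain eq (con c) = refl

  gsubTs-plain : {σ : Sub n m} → (∀ i → γ i ≡ tm (σ i)) → ∀ ts → gsubTs γ ts ≡ just (map (subT σ) ts)
  gsubTs-plain eq []       = refl
  gsubTs-plain eq (t ∷ ts) rewrite gsubT-plain eq t | gsubTs-plain eq ts = refl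

  gsubG-plain : {σ : Sub n m} → (∀ i → γ i ≡ tm (σ i)) → ∀ g → gsubG γ g ≡ just (subG σ g)
  gsubL-plain : {σ : Sub n m} → (∀ i → γ i ≡ tm (σ i)) → ∀ A → gsubL γ A ≡ just (subL σ A)

  gsubG-plain eq (tm (bv i))  = cong just (eq i)
  gsubG-plain eq (tm (fv a))  = refl
  gsubG-plain eq (tm (con c)) = refl
  gsubG-plain eq (ι A) rewrite gsubL-plain (gliftS-plain eq) A = refl

  gsubL-plain eq (pred P ts) rewrite gsubTs-plain eq ts = refl
  gsubL-plain eq (E! t)      rewrite gsubT-plain eq t = refl
  gsubL-plain eq (s ≐ t)     rewrite gsubG-plain eq s | gsubG-plain eq t = refl
  gsubL-plain eq ⊥'          = refl
  gsubL-plain eq (A ∧' B)    rewrite gsubL-plain eq A | gsubL-plain eq B = refl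
  gsubL-plain eq (A ∨' B)    rewrite gsubL-plain eq A | gsubL-plain eq B = refl
  gsubL-plain eq (A ⇒ B)     rewrite gsubL-plain eq A | gsubL-plain eq B = refl
  gsubL-plain eq (A ⇔ B)     rewrite gsubL-plain eq A | gsubL-plain eq B = refl
  gsubL-plain eq (all A)     rewrite gsubL-plain (gliftS-plain eq) A = refl
  gsubL-plain eq (ex A)      rewrite gsubL-plain (gliftS-plain eq) A = refl
  gsubL-plain eq (Δ B t)     rewrite gsubL-plain (gliftS-plain eq) B | gsubG-plain eq t = refl

  gopen₁-plain : (A : LForm (suc n)) (t : Term n) → gopen₁ A (tm t) ≡ just (open₁ A t)
  gopen₁-plain A t = gsubL-plain single-plain A
    where
    single-plain : ∀ i → gsingle (tm t) i ≡ tm (single t i)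
    single-plain zero    = refl
    single-plain (suc i) = refl

  data SubstG (γ : GSub n m) : GTerm n → GTerm m → Set
  data Subst (γ : GSub n m) : LForm n → LForm m → Set

  data SubstG γ where
    var : ∀ i → SubstG γ (tm (bv i)) (γ i)
    fv  : ∀ a → SubstG γ (tm (fv a)) (tm (fv a))
    con : ∀ c → SubstG γ (tm (con c)) (tm (con c))
    ι   : ∀ {A A′} → Subst (gliftS γ) A A′ → SubstG γ (ι A) (ι A′)

  data Subst γ where
    pred : ∀ {P ts ts′} → gsubTs γ ts ≡ just ts′ → Subst γ (pred P ts) (pred P ts′)
    E!   : ∀ {t t′} → gsubT γ t ≡ just t′ → Subst γ (E! t) (E! t′)
    _≐_  : ∀ {s s′ t t′} → SubstG γ s s′ → SubstG γ t t′ → Subst γ (s ≐ t) (s′ ≐ t′)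
    ⊥'   : Subst γ ⊥' ⊥'
    _∧'_ : ∀ {A A′ B B′} → Subst γ A A′ → Subst γ B B′ → Subst γ (A ∧' B) (A′ ∧' B′)
    _∨'_ : ∀ {A A′ B B′} → Subst γ A A′ → Subst γ B B′ → Subst γ (A ∨' B) (A′ ∨' B′)
    _⇒_  : ∀ {A A′ B B′} → Subst γ A A′ → Subst γ B B′ → Subst γ (A ⇒ B) (A′ ⇒ B′)
    _⇔_  : ∀ {A A′ B B′} → Subst γ A A′ → Subst γ B B′ → Subst γ (A ⇔ B) (A′ ⇔ B′)
    all  : ∀ {A A′} → Subst (gliftS γ) A A′ → Subst γ (all A) (all A′)
    ex   : ∀ {A A′} → Subst (gliftS γ) A A′ → Subst γ (ex A) (ex A′)
    Δ    : ∀ {B B′ g g′} → Subst (gliftS γ) B B′ → SubstG γ g g′ → Subst γ (Δ B g) (Δ B′ g′)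

  gsubG-graph : ∀ g {g′} → gsubG γ g ≡ just g′ → SubstG γ g g′
  gsubL-graph : ∀ A {A′} → gsubL γ A ≡ just A′ → Subst γ A A′

  gsubG-graph (tm (bv i))  refl = var i
  gsubG-graph (tm (fv a))  refl = fv a
  gsubG-graph (tm (con c)) refl = con c
  gsubG-graph {γ = γ} (ι A) e with gsubL (gliftS γ) A in eA
  gsubG-graph (ι A) refl | just _ = ι (gsubL-graph A eA)

  gsubL-graph {γ = γ} (pred P ts) e with gsubTs γ ts in eq
  gsubL-graph (pred P ts) refl | just _ = pred eq
  gsubL-graph {γ = γ} (E! t) e with gsubT γ t in eq
  gsubL-graph (E! t) refl | just _ = E! eq
  gsubL-graph {γ = γ} (s ≐ t) e with gsubG γ s in es | gsubG γ t in et
  gsubL-graph (s ≐ t) refl | just _ | just _ = gsubG-graph s es ≐ gsubG-graph t et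
  gsubL-graph ⊥' refl = ⊥'
  gsubL-graph {γ = γ} (A ∧' B) e with gsubL γ A in eA | gsubL γ B in eB
  gsubL-graph (A ∧' B) refl | just _ | just _ = gsubL-graph A eA ∧' gsubL-graph B eB
  gsubL-graph {γ = γ} (A ∨' B) e with gsubL γ A in eA | gsubL γ B in eB
  gsubL-graph (A ∨' B) refl | just _ | just _ = gsubL-graph A eA ∨' gsubL-graph B eB
  gsubL-graph {γ = γ} (A ⇒ B) e with gsubL γ A in eA | gsubL γ B in eB
  gsubL-graph (A ⇒ B) refl | just _ | just _ = gsubL-graph A eA ⇒ gsubL-graph B eB
  gsubL-graph {γ = γ} (A ⇔ B) e with gsubL γ A in eA | gsubL γ B in eB
  gsubL-graph (A ⇔ B) refl | just _ | just _ = gsubL-graph A eA ⇔ gsubL-graph B eB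
  gsubL-graph {γ = γ} (all A) e with gsubL (gliftS γ) A in eA
  gsubL-graph (all A) refl | just _ = all (gsubL-graph A eA)
  gsubL-graph {γ = γ} (ex A) e with gsubL (gliftS γ) A in eA
  gsubL-graph (ex A) refl | just _ = ex (gsubL-graph A eA)
  gsubL-graph {γ = γ} (Δ B g) e with gsubL (gliftS γ) B in eB | gsubG γ g in eg
  gsubL-graph (Δ B g) refl | just _ | just _ = Δ (gsubL-graph B eB) (gsubG-graph g eg)

  private
    variable
      δ : GSub n k

  gsubT-subT : (θ : Sub m k) → (∀ i → δ i ≡ subG θ (γ i)) →
               ∀ t {t′} → gsubT γ t ≡ just t′ → gsubT δ t ≡ just (subT θ t′)
  gsubT-subT {γ = γ} θ eq (bv i) e with γ i | eq i
  ... | tm u | δi with refl ← e rewrite δi = refl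
  gsubT-subT θ eq (fv a)  refl = refl
  gsubT-subT θ eq (con c) refl = refl

  gsubTs-subT : (θ : Sub m k) → (∀ i → δ i ≡ subG θ (γ i)) →
                ∀ ts {ts′} → gsubTs γ ts ≡ just ts′ → gsubTs δ ts ≡ just (map (subT θ) ts′)
  gsubTs-subT θ eq [] refl = refl
  gsubTs-subT {γ = γ} θ eq (t ∷ ts) e with gsubT γ t in et | gsubTs γ ts in ets
  gsubTs-subT θ eq (t ∷ ts) refl | just _ | just _
    rewrite gsubT-subT θ eq t et | gsubTs-subT θ eq ts ets = refl

  SubstG-subG : (θ : Sub m k) → (∀ i → δ i ≡ subG θ (γ i)) →
                ∀ {g g′} → SubstG γ g g′ → SubstG δ g (subG θ g′)
  Subst-subL : (θ : Sub m k) → (∀ i → δ i ≡ subG θ (γ i)) →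
               ∀ {A A′} → Subst γ A A′ → Subst δ A (subL θ A′)

  private
    gliftS-subG : (θ : Sub m k) → (∀ i → δ i ≡ subG θ (γ i)) →
                  ∀ i → gliftS δ i ≡ subG (liftS θ) (gliftS γ i)
    gliftS-subG θ eq zero    = refl
    gliftS-subG {γ = γ} θ eq (suc i) = trans (cong (renG suc) (eq i)) (sym (subG-renG-suc θ (γ i)))

  SubstG-subG θ eq (var i) = subst (SubstG _ _) (eq i) (var i)
  SubstG-subG θ eq (fv a)  = fv a
  SubstG-subG θ eq (con c) = con c
  SubstG-subG θ eq (ι A)   = ι (Subst-subL (liftS θ) (gliftS-subG θ eq) A)

  Subst-subL θ eq (pred {ts = ts} e) = pred (gsubTs-subT θ eq ts e)
  Subst-subL θ eq (E! {t = t} e)     = E! (gsubT-subT θ eq t e)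
  Subst-subL θ eq (s ≐ t)  = SubstG-subG θ eq s ≐ SubstG-subG θ eq t
  Subst-subL θ eq ⊥'       = ⊥'
  Subst-subL θ eq (A ∧' B) = Subst-subL θ eq A ∧' Subst-subL θ eq B
  Subst-subL θ eq (A ∨' B) = Subst-subL θ eq A ∨' Subst-subL θ eq B
  Subst-subL θ eq (A ⇒ B)  = Subst-subL θ eq A ⇒ Subst-subL θ eq B
  Subst-subL θ eq (A ⇔ B)  = Subst-subL θ eq A ⇔ Subst-subL θ eq B
  Subst-subL θ eq (all A)  = all (Subst-subL (liftS θ) (gliftS-subG θ eq) A)
  Subst-subL θ eq (ex A)   = ex (Subst-subL (liftS θ) (gliftS-subG θ eq) A)
  Subst-subL θ eq (Δ B g)  = Δ (Subst-subL (liftS θ) (gliftS-subG θ eq) B) (SubstG-subG θ eq g)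

  Subst-open₁ : (u : Term m) → ∀ {B B′} → Subst (gliftS γ) B B′ → Subst (tm u ∷ₛ γ) B (open₁ B′ u)
  Subst-open₁ {γ = γ} u = Subst-subL (single u) single-gliftS
    where
    single-gliftS : ∀ i → (tm u ∷ₛ γ) i ≡ subG (single u) (gliftS γ i)
    single-gliftS zero    = refl
    single-gliftS (suc i) = sym (subG-single-renG-suc u (γ i))

module TranslationSubstitution where

  open Iota using (Form; subF; renF)
  open LLΔ using (LForm; GTerm; tm; ι; subL; subG; renL)
  open IotaSubstitution
  open LLΔSubstitution

  renF-subF-comm : (ρ : Fin m → Fin k) (σ : Sub n m) (ρ′ : Fin n → Fin l) (σ′ : Sub l k) →
                   (∀ i → renT ρ (σ i) ≡ σ′ (ρ′ i)) → ∀ A → renF ρ (subF σ A) ≡ subF σ′ (renF ρ′ A)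
  renF-subF-comm ρ σ ρ′ σ′ comm A =
    trans (renF-as-subF ρ (subF σ A))
      (trans (subF-subF (bv ∘ ρ) σ A)
        (sym (trans (cong (subF σ′) (renF-as-subF ρ′ A))
          (trans (subF-subF σ′ (bv ∘ ρ′) A)
            (subF-cong (λ i → sym (trans (sym (renT-as-subT ρ (σ i))) (comm i))) A)))))

  τ-subL : (σ : Sub n m) (A : LForm n) → τ (subL σ A) ≡ subF σ (τ A)
  τ-subL σ (LLΔ.pred P ts) = refl
  τ-subL σ (LLΔ.E! t)      = refl
  τ-subL σ (tm s LLΔ.≐ tm t) = refl
  τ-subL σ (ι A LLΔ.≐ tm t) =
    cong₂ Iota.the (τ-subL (liftS σ) A) (cong (bv zero Iota.≐_) (sym (subT-liftS-renT-suc σ t)))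
  τ-subL σ (tm t LLΔ.≐ ι A) =
    cong₂ Iota.the (τ-subL (liftS σ) A) (cong (Iota._≐ bv zero) (sym (subT-liftS-renT-suc σ t)))
  τ-subL σ (ι A LLΔ.≐ ι B) =
    cong₂ Iota.the (τ-subL (liftS σ) A)
      (cong (λ X → Iota.the X _) (trans (cong (renF (liftR suc)) (τ-subL (liftS σ) B))
        (renF-subF-comm (liftR suc) (liftS σ) (liftR suc) (liftS (liftS σ)) lift-comm (τ B))))
    where
    lift-comm : ∀ i → renT (liftR suc) (liftS σ i) ≡ liftS (liftS σ) (liftR suc i)
    lift-comm zero = refl
    lift-comm (suc i) with σ i
    ... | bv j  = refl
    ... | fv a  = refl
    ... | con c = refl
  τ-subL σ LLΔ.⊥'          = refl
  τ-subL σ (A LLΔ.∧' B)    = cong₂ Iota._∧'_ (τ-subL σ A) (τ-subL σ B)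
  τ-subL σ (A LLΔ.∨' B)    = cong₂ Iota._∨'_ (τ-subL σ A) (τ-subL σ B)
  τ-subL σ (A LLΔ.⇒ B)     = cong₂ Iota._⇒_ (τ-subL σ A) (τ-subL σ B)
  τ-subL σ (A LLΔ.⇔ B)     = cong₂ Iota._⇔_ (τ-subL σ A) (τ-subL σ B)
  τ-subL σ (LLΔ.all A)     = cong Iota.all (τ-subL (liftS σ) A)
  τ-subL σ (LLΔ.ex A)      = cong Iota.ex (τ-subL (liftS σ) A)
  τ-subL σ (LLΔ.Δ B (tm t)) =
    cong₂ Iota.the (cong (Iota._≐ bv zero) (sym (subT-liftS-renT-suc σ t))) (τ-subL (liftS σ) B)
  τ-subL σ (LLΔ.Δ B (ι A)) = cong₂ Iota.the (τ-subL (liftS σ) A) (τ-subL (liftS σ) B)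

  τ-renL : (ρ : Fin n → Fin m) (A : LForm n) → τ (renL ρ A) ≡ renF ρ (τ A)
  τ-renL ρ A = trans (cong τ (renL-as-subL ρ A)) (trans (τ-subL (bv ∘ ρ) A) (sym (renF-as-subF ρ (τ A))))

  υ-subF : (σ : Sub n m) (A : Form n) → υ (subF σ A) ≡ subL σ (υ A)
  υ-subF σ (Iota.pred P ts) = refl
  υ-subF σ (Iota.E! t)      = refl
  υ-subF σ (s Iota.≐ t)     = refl
  υ-subF σ Iota.⊥'          = refl
  υ-subF σ (A Iota.∧' B)    = cong₂ LLΔ._∧'_ (υ-subF σ A) (υ-subF σ B)
  υ-subF σ (A Iota.∨' B)    = cong₂ LLΔ._∨'_ (υ-subF σ A) (υ-subF σ B)
  υ-subF σ (A Iota.⇒ B)     = cong₂ LLΔ._⇒_ (υ-subF σ A) (υ-subF σ B)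
  υ-subF σ (A Iota.⇔ B)     = cong₂ LLΔ._⇔_ (υ-subF σ A) (υ-subF σ B)
  υ-subF σ (Iota.all A)     = cong LLΔ.all (υ-subF (liftS σ) A)
  υ-subF σ (Iota.ex A)      = cong LLΔ.ex (υ-subF (liftS σ) A)
  υ-subF σ (Iota.the A B)   = cong₂ LLΔ.Δ (υ-subF (liftS σ) B) (cong ι (υ-subF (liftS σ) A))

  private
    ++⁺-swap : {ws xs ys zs : List ℕ} → ws ⊆ xs → ys ⊆ zs → ws ++ ys ⊆ zs ++ xs
    ++⁺-swap {xs = xs} {zs = zs} p q = ⊆-trans (++⁺ p q) (⊆-reflexive-↭ (++-comm xs zs))

    namesT-weaken : (t : Term n) → namesT (renT suc t) ++ [] ⊆ namesT t
    namesT-weaken t = ⊆-reflexive (trans (++-identityʳ _) (namesT-renT suc t))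

  names-τ : (A : LForm n) → Iota.names (τ A) ⊆ LLΔ.names A
  names-τ (LLΔ.pred P ts) = ⊆-refl
  names-τ (LLΔ.E! t)      = ⊆-refl
  names-τ (tm s LLΔ.≐ tm t) = ⊆-refl
  names-τ (ι A LLΔ.≐ tm t)  = ++⁺ (names-τ A) (⊆-reflexive (namesT-renT suc t))
  names-τ (tm t LLΔ.≐ ι A)  = ++⁺-swap (names-τ A) (namesT-weaken t)
  names-τ (ι A LLΔ.≐ ι B)   =
    ++⁺ (names-τ A) (⊆-trans (⊆-reflexive (trans (++-identityʳ _) (names-renF (liftR suc) (τ B)))) (names-τ B))
  names-τ LLΔ.⊥'          = ⊆-refl
  names-τ (A LLΔ.∧' B)    = ++⁺ (names-τ A) (names-τ B)
  names-τ (A LLΔ.∨' B)    = ++⁺ (names-τ A) (names-τ B)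
  names-τ (A LLΔ.⇒ B)     = ++⁺ (names-τ A) (names-τ B)
  names-τ (A LLΔ.⇔ B)     = ++⁺ (names-τ A) (names-τ B)
  names-τ (LLΔ.all A)     = names-τ A
  names-τ (LLΔ.ex A)      = names-τ A
  names-τ (LLΔ.Δ B (tm t)) = ++⁺-swap (namesT-weaken t) (names-τ B)
  names-τ (LLΔ.Δ B (ι A))  = ++⁺-swap (names-τ A) (names-τ B)

  names-υ : (A : Form n) → LLΔ.names (υ A) ⊆ Iota.names A
  names-υ (Iota.pred P ts) = ⊆-refl
  names-υ (Iota.E! t)      = ⊆-refl
  names-υ (s Iota.≐ t)     = ⊆-refl
  names-υ Iota.⊥'          = ⊆-refl
  names-υ (A Iota.∧' B)    = ++⁺ (names-υ A) (names-υ B)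
  names-υ (A Iota.∨' B)    = ++⁺ (names-υ A) (names-υ B)
  names-υ (A Iota.⇒ B)     = ++⁺ (names-υ A) (names-υ B)
  names-υ (A Iota.⇔ B)     = ++⁺ (names-υ A) (names-υ B)
  names-υ (Iota.all A)     = names-υ A
  names-υ (Iota.ex A)      = names-υ A
  names-υ (Iota.the A B)   = ++⁺-swap (names-υ B) (names-υ A)

  namesCtx-τ : (Γ : List (LForm 0)) → Iota.namesCtx (map τ Γ) ⊆ LLΔ.namesCtx Γ
  namesCtx-τ []      = ⊆-refl
  namesCtx-τ (A ∷ Γ) = ++⁺ (names-τ A) (namesCtx-τ Γ)

  namesCtx-υ : (Γ : List (Form 0)) → LLΔ.namesCtx (map υ Γ) ⊆ Iota.namesCtx Γ
  namesCtx-υ []      = ⊆-refl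
  namesCtx-υ (A ∷ Γ) = ++⁺ (names-υ A) (namesCtx-υ Γ)

module LLΔDeduction where

  open LLΔ
  open GeneralSubstitution using (gopen₁-plain)

  private
    variable
      Γ : List (LForm 0)
      a b c : Term 0

  =E-at : ∀ {B₁ B₂} (A : LForm 1) → Atomic A → open₁ A a ≡ B₁ → open₁ A b ≡ B₂ →
             Γ ⊢ tm a ≐ tm b → Γ ⊢ B₁ → Γ ⊢ B₂
  =E-at {a = a} {b} A at refl refl = =E A at (gopen₁-plain A a) (gopen₁-plain A b)

  =E-pred : ∀ {P} us vs → Γ ⊢ tm a ≐ tm b → Γ ⊢ pred P (us ++ a ∷ vs) → Γ ⊢ pred P (us ++ b ∷ vs)
  =E-pred {a = a} {b} {P} us vs =
    =E-at (pred P (hole us vs)) at-pred (cong (pred P) (open-hole a us vs)) (cong (pred P) (open-hole b us vs))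

  =E-≐ˡ : Γ ⊢ tm a ≐ tm b → Γ ⊢ tm a ≐ tm c → Γ ⊢ tm b ≐ tm c
  =E-≐ˡ {a = a} {b} {c} =
    =E-at (tm (bv zero) ≐ tm (renT suc c)) at-≐
      (cong (λ u → tm a ≐ tm u) (subT-single-renT-suc a c)) (cong (λ u → tm b ≐ tm u) (subT-single-renT-suc b c))

  =E-≐ʳ : Γ ⊢ tm a ≐ tm b → Γ ⊢ tm c ≐ tm a → Γ ⊢ tm c ≐ tm b
  =E-≐ʳ {a = a} {b} {c} =
    =E-at (tm (renT suc c) ≐ tm (bv zero)) at-≐
      (cong (λ u → tm u ≐ tm a) (subT-single-renT-suc a c)) (cong (λ u → tm u ≐ tm b) (subT-single-renT-suc b c))

  INFLLΔ : NaturalDeduction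
  INFLLΔ = record
    { LLΔ hiding (_≐_) renaming (LForm to Form)
    ; _≐_     = λ a b → tm a ≐ tm b
    ; =E-pred = =E-pred
    ; =E-E!   = =E-at (E! (bv zero)) at-E! refl refl
    ; =E-≐ˡ   = =E-≐ˡ
    ; =E-≐ʳ   = =E-≐ʳ
    }

module LLΔForcing where

  open LLΔ using (LForm; GTerm; tm; ι; pred; E!; _≐_; _∧'_; _⇔_; all; ex; Δ; open₁; subL; renL; LL; Δι)
  open LLΔSubstitution
  open LLΔDeduction using (INFLLΔ)
  open Forcing INFLLΔ public

  private
    variable
      Γ : Ctx
      a b t : Term 0
      C : LForm 0
      A A′ B B′ : LForm 1

  lambert-inst : Γ ⊩ E! t → Γ ⊩ (ι A ≐ tm t) ⇔ all (A ⇔ (tm (bv zero) ≐ tm (renT suc t)))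
  lambert-inst {t = t} {A = A} e =
    ⊩-resp-≡ (cong (λ X → (ι X ≐ tm t) ⇔ all (X ⇔ _)) (subL-liftS-single-inject₁ t A)) (∀E (λ _ → LL A) e)

  lambert-elim : Γ ⊩ ι A ≐ tm t → Γ ⊩ E! a → Γ ⊩ open₁ A a ⇔ (tm a ≐ tm t)
  lambert-elim {A = A} {t} {a} d e =
    ⊩-resp-≡ (cong (λ u → open₁ A a ⇔ (tm a ≐ tm u)) (subT-single-renT-suc a t))
      (∀E (⇔E₁ (lambert-inst (λ s → LLΔ.AD-≐₂ (d s))) d) e)

  lambert-intro : Γ ⊩ E! t →
                  (∀[ Δ ⊇ Γ ] ∀ x → Δ ⊩ E! (fv x) → Δ ⊩ open₁ A (fv x) ⇔ (tm (fv x) ≐ tm t)) →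
                  Γ ⊩ ι A ≐ tm t
  lambert-intro {t = t} {A = A} e k = ⇔E₂ (lambert-inst e) (∀I λ s x ex →
    ⊩-resp-≡ (cong (λ u → open₁ A (fv x) ⇔ (tm (fv x) ≐ tm u)) (sym (subT-single-renT-suc (fv x) t))) (k s x ex))

  Δι-body : (A B : LForm 1) (u : Term 0) →
            open₁ ((ι (renL inject₁ A) ≐ tm (bv zero)) ∧' B) u ≡ ((ι A ≐ tm u) ∧' open₁ B u)
  Δι-body A B u = cong (λ X → (ι X ≐ tm u) ∧' open₁ B u) (subL-liftS-single-inject₁ u A)

  Δι-elim : Γ ⊩ Δ B (ι A) →
            (∀[ Δ ⊇ Γ ] ∀ y → Δ ⊩ ι A ≐ tm (fv y) → Δ ⊩ open₁ B (fv y) → Δ ⊩ E! (fv y) → Δ ⊩ C) →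
            Γ ⊩ C
  Δι-elim {B = B} {A = A} d k = ∃E (⇔E₁ (λ _ → Δι A B) d) λ s y p ey →
    let p′ = ⊩-resp-≡ (Δι-body A B (fv y)) p in k s y (∧E₁ p′) (∧E₂ p′) ey

  ΔιE¹ : Γ ⊩ Δ B (ι A) →
         (∀[ Δ ⊇ Γ ] ∀ y → Δ ⊩ open₁ A (fv y) → Δ ⊩ open₁ B (fv y) → Δ ⊩ E! (fv y) → Δ ⊩ C) →
         Γ ⊩ C
  ΔιE¹ d k = Δι-elim d λ s y ιA≐y by ey → k s y (⇔E₂ (lambert-elim ιA≐y ey) (=Iⁿ ey)) by ey

  ΔιE² : Γ ⊩ Δ B (ι A) → Γ ⊩ E! a → Γ ⊩ E! b → Γ ⊩ open₁ A a → Γ ⊩ open₁ A b →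
         Γ ⊩ tm a ≐ tm b
  ΔιE² d ea eb aa ab = Δι-elim d λ s y ιA≐y _ _ →
    ≐-trans (⇔E₁ (lambert-elim ιA≐y (⊩-mono s ea)) (⊩-mono s aa))
            (≐-sym (⇔E₁ (lambert-elim ιA≐y (⊩-mono s eb)) (⊩-mono s ab)))

  ΔιI : Γ ⊩ open₁ A t → Γ ⊩ open₁ B t → Γ ⊩ E! t →
        (∀[ Δ ⊇ Γ ] ∀ y → Δ ⊩ open₁ A (fv y) → Δ ⊩ E! (fv y) → Δ ⊩ tm (fv y) ≐ tm t) →
        (∀[ Δ ⊇ Γ ] ∀ y → Δ ⊩ tm (fv y) ≐ tm t → Δ ⊩ open₁ A (fv y)) →
        Γ ⊩ Δ B (ι A)
  ΔιI {A = A} {t} {B = B} at bt et unique replace =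
    ⇔E₂ (λ _ → Δι A B) (∃I (⊩-resp-≡ (sym (Δι-body A B t))
      (∧I (lambert-intro et λ s x ex → ⇔I (λ s′ ax → unique (⊆-trans s s′) x ax (⊩-mono s′ ex))
                                            (λ s′ → replace (⊆-trans s s′) x))
          bt)) et)

  Substitutive : Ctx → LForm 1 → Set
  Substitutive Γ A =
    ∀[ Δ ⊇ Γ ] ∀ w y → Δ ⊩ tm (fv w) ≐ tm (fv y) → Δ ⊩ open₁ A (fv y) → Δ ⊩ open₁ A (fv w)

  Δι-mono : Pointwise⇔ Γ A A′ →
            (∀[ Δ ⊇ Γ ] ∀ y → Δ ⊩ open₁ A (fv y) → Δ ⊩ open₁ B (fv y) → Δ ⊩ open₁ B′ (fv y)) →
            Substitutive Γ A′ → Γ ⊩ Δ B (ι A) → Γ ⊩ Δ B′ (ι A′)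
  Δι-mono eA eB replace d = ΔιE¹ d λ s y ay by ey →
    ΔιI (⇔E₁ (eA s y) ay) (eB s y ay by) ey
      (λ s′ w a′w ew → ΔιE² (⊩-mono (⊆-trans s s′) d) ew (⊩-mono s′ ey)
                              (⇔E₂ (eA (⊆-trans s s′) w) a′w) (⊩-mono s′ ay))
      (λ s′ w w≐y → replace (⊆-trans s s′) w y w≐y (⊩-mono s′ (⇔E₁ (eA s y) ay)))

  Δι-cong : Pointwise⇔ Γ A A′ → Pointwise⇔ Γ B B′ → Substitutive Γ A → Substitutive Γ A′ →
            Γ ⊩ Δ B (ι A) ⇔ Δ B′ (ι A′)
  Δι-cong eA eB sA sA′ =
    ⇔I (λ s → Δι-mono (λ s′ → eA (⊆-trans s s′)) (λ s′ y _ → ⇔E₁ (eB (⊆-trans s s′) y))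
                      (λ s′ → sA′ (⊆-trans s s′)))
       (λ s → Δι-mono (λ s′ → Pointwise⇔-sym eA (⊆-trans s s′)) (λ s′ y _ → ⇔E₂ (eB (⊆-trans s s′) y))
                      (λ s′ → sA (⊆-trans s s′)))

  replace : (X : Iota.Form k) {σ σ′ : Sub k 0} → σ ≈[ Γ ] σ′ → Γ ⊩ subL σ (υ X) ⇔ subL σ′ (υ X)
  replace-body : (X : Iota.Form (suc k)) {σ σ′ : Sub k 0} → σ ≈[ Γ ] σ′ →
                 Pointwise⇔ Γ (subL (liftS σ) (υ X)) (subL (liftS σ′) (υ X))
  replace-substitutive : (X : Iota.Form (suc k)) (σ : Sub k 0) → Substitutive Γ (subL (liftS σ) (υ X))

  replace (Iota.pred P ts) h = pred-cong ts h
  replace (Iota.E! t)      h = E!-cong t h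
  replace (s Iota.≐ t)     h = ≐-cong s t h
  replace Iota.⊥'          h = ⇔-refl
  replace (A Iota.∧' B)    h = ∧-cong (replace A h) (replace B h)
  replace (A Iota.∨' B)    h = ∨-cong (replace A h) (replace B h)
  replace (A Iota.⇒ B)     h = ⇒-cong (replace A h) (replace B h)
  replace (A Iota.⇔ B)     h = ⇔-cong (replace A h) (replace B h)
  replace (Iota.all A)     h = all-cong (replace-body A h)
  replace (Iota.ex A)      h = ex-cong (replace-body A h)
  replace (Iota.the F G) {σ} {σ′} h =
    Δι-cong (replace-body F h) (replace-body G h) (replace-substitutive F σ) (replace-substitutive F σ′)

  replace-body X {σ} {σ′} h s y =
    ⊩-resp-≡ (sym (cong₂ _⇔_ (open₁-subL-liftS σ (fv y) (υ X)) (open₁-subL-liftS σ′ (fv y) (υ X))))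
      (replace X (∷ₛ-≈ (inj₁ refl) (≈-mono s h)))

  replace-substitutive X σ s w y w≐y =
    ⊩-resp-≡ (sym (open₁-subL-liftS σ (fv w) (υ X)))
    ∘ ⇔E₂ (replace X (∷ₛ-≈ (inj₂ w≐y) (λ _ → inj₁ refl)))
    ∘ ⊩-resp-≡ (open₁-subL-liftS σ (fv y) (υ X))

  replace₁ : (F : Iota.Form 1) → Γ ⊩ tm a ≐ tm b → Γ ⊩ open₁ (υ F) a → Γ ⊩ open₁ (υ F) b
  replace₁ F e = ⇔E₁ (replace F (single-≈ e))

module υ-Translation where

  open LLΔ using (LForm; tm; ι; E!; _≐_; _⇒_; all; Δ; open₁; renL)
  open LLΔSubstitution
  open GeneralSubstitution using (gopen₁-plain)
  open TranslationSubstitution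
  open LLΔForcing

  private
    variable
      t : Term 0
      Γ : List (LForm 0)

  ∉-++⁺ : ∀ {x : ℕ} {xs ys} → x ∉ xs → x ∉ ys → x ∉ xs ++ ys
  ∉-++⁺ {xs = xs} x∉xs x∉ys = [ x∉xs , x∉ys ]′ ∘ ∈-++⁻ xs

  υ-open₁ : (A : Iota.Form 1) (t : Term 0) → υ (Iota.open₁ A t) ≡ open₁ (υ A) t
  υ-open₁ A t = υ-subF (single t) A

  υ-atomic : {A : Iota.Form n} → Iota.Atomic A → LLΔ.Atomic (υ A)
  υ-atomic Iota.at-pred = LLΔ.at-pred
  υ-atomic Iota.at-E!   = LLΔ.at-E!
  υ-atomic Iota.at-≐    = LLΔ.at-≐

  weaken₀ : LForm 0 → LForm 1
  weaken₀ = renL λ ()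

  open₁-weaken₀ : (C : LForm 0) (u : Term 0) → open₁ (weaken₀ C) u ≡ C
  open₁-weaken₀ C u = subL-renL-inverse (single u) (λ ()) (λ ()) C

  -- A derivation cannot be turned into a forcing, so the premises of ιI and ιE¹ that are
  -- derivations under hypotheses about a fresh z are passed to admissible as ∀-formulas.
  υ-ιI : ∀ {F B} → Γ ⊩ all (υ F ⇒ (tm (bv zero) ≐ tm (renT suc t))) →
         Γ ⊩ open₁ (υ F) t → Γ ⊩ open₁ B t → Γ ⊩ E! t → Γ ⊩ Δ B (ι (υ F))
  υ-ιI {t = t} {F = F} unique ft bt et = ΔιI ft bt et
    (λ s y fy ey → ⇒E (⊩-resp-≡ (cong (λ u → _ ⇒ (tm (fv y) ≐ tm u)) (subT-single-renT-suc (fv y) t))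
                                  (∀E (⊩-mono s unique) ey)) fy)
    (λ s y y≐t → replace₁ F (≐-sym y≐t) (⊩-mono s ft))

  υ-ιE¹ : ∀ {A B C} → Γ ⊩ Δ B (ι A) → Γ ⊩ all (B ⇒ (A ⇒ weaken₀ C)) → Γ ⊩ C
  υ-ιE¹ {A = A} {B} {C} d k = ΔιE¹ d λ s y ay by ey →
    ⇒E (⇒E (⊩-resp-≡ (cong (λ X → _ ⇒ (_ ⇒ X)) (open₁-weaken₀ C (fv y))) (∀E (⊩-mono s k) ey)) by) ay

  υ-sound : ∀ {Γ A} → Γ Iota.⊢ A → map υ Γ LLΔ.⊢ υ A
  υ-sound (Iota.ass p)      = LLΔ.ass (∈-map⁺ υ p)
  υ-sound (Iota.∧I d e)     = LLΔ.∧I (υ-sound d) (υ-sound e)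
  υ-sound (Iota.∧E₁ d)      = LLΔ.∧E₁ (υ-sound d)
  υ-sound (Iota.∧E₂ d)      = LLΔ.∧E₂ (υ-sound d)
  υ-sound (Iota.∨I₁ d)      = LLΔ.∨I₁ (υ-sound d)
  υ-sound (Iota.∨I₂ d)      = LLΔ.∨I₂ (υ-sound d)
  υ-sound (Iota.∨E d e f)   = LLΔ.∨E (υ-sound d) (υ-sound e) (υ-sound f)
  υ-sound (Iota.⇒I d)       = LLΔ.⇒I (υ-sound d)
  υ-sound (Iota.⇒E d e)     = LLΔ.⇒E (υ-sound d) (υ-sound e)
  υ-sound (Iota.⇔I d e)     = LLΔ.⇔I (υ-sound d) (υ-sound e)
  υ-sound (Iota.⇔E₁ d e)    = LLΔ.⇔E₁ (υ-sound d) (υ-sound e)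
  υ-sound (Iota.⇔E₂ d e)    = LLΔ.⇔E₂ (υ-sound d) (υ-sound e)
  υ-sound (Iota.⊥E at d)    = LLΔ.⊥E (υ-atomic at) (υ-sound d)
  υ-sound {Γ} (Iota.∀I {A} y y∉Γ y∉A d) =
    LLΔ.∀I y (y∉Γ ∘ namesCtx-υ Γ) (y∉A ∘ names-υ A) (subst (_ LLΔ.⊢_) (υ-open₁ A (fv y)) (υ-sound d))
  υ-sound (Iota.∀E {A} {t} d e) = subst (_ LLΔ.⊢_) (sym (υ-open₁ A t)) (LLΔ.∀E (υ-sound d) (υ-sound e))
  υ-sound (Iota.∃I {A} {t} d e) = LLΔ.∃I (subst (_ LLΔ.⊢_) (υ-open₁ A t) (υ-sound d)) (υ-sound e)
  υ-sound {Γ} {C} (Iota.∃E {A} y y∉Γ y∉A y∉C d e) =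
    LLΔ.∃E y (y∉Γ ∘ namesCtx-υ Γ) (y∉A ∘ names-υ A) (y∉C ∘ names-υ C) (υ-sound d)
      (subst (λ X → X ∷ _ LLΔ.⊢ _) (υ-open₁ A (fv y)) (υ-sound e))
  υ-sound (Iota.=Iⁿ d)      = LLΔ.=Iⁿ (υ-sound d)
  υ-sound (Iota.=E {t₁} {t₂} A at d e) =
    subst (_ LLΔ.⊢_) (sym (υ-open₁ A t₂))
      (LLΔ.=E (υ A) (υ-atomic at) (gopen₁-plain (υ A) t₁) (gopen₁-plain (υ A) t₂)
        (υ-sound d) (subst (_ LLΔ.⊢_) (υ-open₁ A t₁) (υ-sound e)))
  υ-sound (Iota.AD-pred d p) = LLΔ.AD-pred (υ-sound d) p
  υ-sound (Iota.AD-E! d)     = LLΔ.AD-E! (υ-sound d)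
  υ-sound (Iota.AD-≐₁ d)     = LLΔ.AD-≐₁ (υ-sound d)
  υ-sound (Iota.AD-≐₂ d)     = LLΔ.AD-≐₂ (υ-sound d)
  υ-sound {Γ} (Iota.ιI {F} {G} {t} z z∉Γ z∉t z∉F z∉G f g e unique) =
    admissible (λ { (u ∷ f ∷ g ∷ e ∷ []) → υ-ιI {F = F} u f g e })
      (unique′ ∷ subst (_ LLΔ.⊢_) (υ-open₁ F t) (υ-sound f) ∷ subst (_ LLΔ.⊢_) (υ-open₁ G t) (υ-sound g)
               ∷ υ-sound e ∷ [])
    where
    unique′ : map υ Γ LLΔ.⊢ all (υ F ⇒ (tm (bv zero) ≐ tm (renT suc t)))
    unique′ = LLΔ.∀I z (z∉Γ ∘ namesCtx-υ Γ)
      (∉-++⁺ (z∉F ∘ names-υ F) (z∉t ∘ subst (z ∈_) (namesT-renT suc t)))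
      (subst (λ u → _ LLΔ.⊢ _ ⇒ (tm (fv z) ≐ tm u)) (sym (subT-single-renT-suc (fv z) t))
        (LLΔ.⇒I (subst (λ X → X ∷ _ LLΔ.⊢ _) (υ-open₁ F (fv z)) (υ-sound unique))))
  υ-sound {Γ} {C} (Iota.ιE¹ {F} {G} z z∉Γ z∉C z∉F z∉G d k) =
    admissible (λ { (d ∷ k ∷ []) → υ-ιE¹ d k }) (υ-sound d ∷ k′ ∷ [])
    where
    k′ : map υ Γ LLΔ.⊢ all (υ G ⇒ (υ F ⇒ weaken₀ (υ C)))
    k′ = LLΔ.∀I z (z∉Γ ∘ namesCtx-υ Γ)
      (∉-++⁺ (z∉G ∘ names-υ G)
        (∉-++⁺ (z∉F ∘ names-υ F) (z∉C ∘ names-υ C ∘ subst (z ∈_) (names-renL _ (υ C)))))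
      (subst (λ X → _ LLΔ.⊢ _ ⇒ (_ ⇒ X)) (sym (open₁-weaken₀ (υ C) (fv z)))
        (LLΔ.⇒I (LLΔ.⇒I
          (subst₂ (λ X Y → X ∷ Y ∷ _ LLΔ.⊢ _) (υ-open₁ F (fv z)) (υ-open₁ G (fv z)) (υ-sound k)))))
  υ-sound (Iota.ιE² {F} {G} {t₁} {t₂} d e₁ e₂ f₁ f₂) =
    admissible (λ { (d ∷ e₁ ∷ e₂ ∷ f₁ ∷ f₂ ∷ []) → ΔιE² d e₁ e₂ f₁ f₂ })
      (υ-sound d ∷ υ-sound e₁ ∷ υ-sound e₂ ∷ subst (_ LLΔ.⊢_) (υ-open₁ F t₁) (υ-sound f₁)
        ∷ subst (_ LLΔ.⊢_) (υ-open₁ F t₂) (υ-sound f₂) ∷ [])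

module τ-Translation where

  open Iota using (Form; E!; _≐_; _∧'_; _⇔_; all; ex; the; open₁; subF; renF)
  open LLΔ using (LForm; GTerm; tm; ι; gopen₁; gsingle; gsubT; gsubTs; gliftS; subL; subG)
  open IotaSubstitution
  open LLΔSubstitution using (open₁-subL-liftS)
  open GeneralSubstitution
  open TranslationSubstitution
  open IotaForcing

  private
    variable
      Γ : Ctx
      a b t : Term 0
      C : Form 0
      F G : Form 1
      γ : GSub k 0
      ρ : Sub k 0

  infix 7 _describes_
  _describes_ : Form 1 → Term 0 → Form 0
  F describes a = the F (bv zero ≐ renT suc a)

  open₁-≐-weakenʳ : (a w : Term 0) → open₁ (bv zero ≐ renT suc a) w ≡ (w ≐ a)
  open₁-≐-weakenʳ a w = cong (w ≐_) (subT-single-renT-suc w a)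

  open₁-≐-weakenˡ : (a w : Term 0) → open₁ (renT suc a ≐ bv zero) w ≡ (a ≐ w)
  open₁-≐-weakenˡ a w = cong (_≐ w) (subT-single-renT-suc w a)

  describes-elim : Γ ⊩ F describes a →
                   (∀[ Δ ⊇ Γ ] ∀ w → Δ ⊩ open₁ F (fv w) → Δ ⊩ fv w ≐ a → Δ ⊩ C) → Γ ⊩ C
  describes-elim {a = a} d k = ιE¹ d λ s w fw w≐a _ → k s w fw (⊩-resp-≡ (open₁-≐-weakenʳ a (fv w)) w≐a)

  describes-intro : Γ ⊩ open₁ F t → Γ ⊩ E! t →
                    (∀[ Δ ⊇ Γ ] ∀ w → Δ ⊩ open₁ F (fv w) → Δ ⊩ E! (fv w) → Δ ⊩ fv w ≐ t) →
                    Γ ⊩ F describes t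
  describes-intro {t = t} ft et = ιI ft (⊩-resp-≡ (sym (open₁-≐-weakenʳ t t)) (=Iⁿ et)) et

  describes-flip : Γ ⊩ the F (renT suc a ≐ bv zero) ⇔ F describes a
  describes-flip {a = a} = the-cong (λ _ _ → ⇔-refl) λ _ w →
    ⊩-resp-≡ (sym (cong₂ _⇔_ (open₁-≐-weakenˡ a (fv w)) (open₁-≐-weakenʳ a (fv w))))
      (⇔I (λ _ → ≐-sym) (λ _ → ≐-sym))

  describes-E! : Γ ⊩ F describes a → Γ ⊩ E! a
  describes-E! d = describes-elim d λ _ _ _ → AD-≐₂

  describes-holds : Γ ⊩ F describes a → Γ ⊩ open₁ F a
  describes-holds {F = F} d = describes-elim d λ _ _ fw w≐a → replace₁ F w≐a fw

  the-unique : Γ ⊩ the F G → Γ ⊩ open₁ F a → Γ ⊩ E! a →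
               ∀[ Δ ⊇ Γ ] ∀ w → Δ ⊩ open₁ F (fv w) → Δ ⊩ E! (fv w) → Δ ⊩ fv w ≐ a
  the-unique d fa ea s w fw ew = ιE² (⊩-mono s d) ew (⊩-mono s ea) fw (⊩-mono s fa)

  the-describes : Γ ⊩ the F G → Γ ⊩ open₁ F a → Γ ⊩ E! a → Γ ⊩ F describes a
  the-describes d fa ea = describes-intro fa ea (the-unique d fa ea)

  describes-only : Γ ⊩ F describes a →
                   ∀[ Δ ⊇ Γ ] ∀ w → Δ ⊩ open₁ F (fv w) → Δ ⊩ E! (fv w) → Δ ⊩ fv w ≐ a
  describes-only d = the-unique d (describes-holds d) (describes-E! d)

  describes-unique : Γ ⊩ F describes a → Γ ⊩ F describes b → Γ ⊩ a ≐ b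
  describes-unique da db = ιE² da (describes-E! da) (describes-E! db) (describes-holds da) (describes-holds db)

  describes-resp : Γ ⊩ F describes a → Γ ⊩ a ≐ b → Γ ⊩ F describes b
  describes-resp {F = F} d a≐b = the-describes d (replace₁ F a≐b (describes-holds d)) (AD-≐₂ a≐b)

  graph-elim : Γ ⊩ all (F ⇔ (bv zero ≐ renT suc t)) → Γ ⊩ E! a → Γ ⊩ open₁ F a ⇔ (a ≐ t)
  graph-elim {t = t} {a = a} d ea = ⊩-resp-≡ (cong (λ u → _ ⇔ (a ≐ u)) (subT-single-renT-suc a t)) (∀E d ea)

  graph-intro : (∀[ Δ ⊇ Γ ] ∀ x → Δ ⊩ E! (fv x) → Δ ⊩ open₁ F (fv x) ⇔ (fv x ≐ t)) →
                Γ ⊩ all (F ⇔ (bv zero ≐ renT suc t))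
  graph-intro {t = t} k = ∀I λ s x ex →
    ⊩-resp-≡ (cong (λ u → _ ⇔ (fv x ≐ u)) (sym (subT-single-renT-suc (fv x) t))) (k s x ex)

  lambert-ι : (F : Form 1) → Γ ⊩ E! t → Γ ⊩ F describes t ⇔ all (F ⇔ (bv zero ≐ renT suc t))
  lambert-ι F et = ⇔I
    (λ s d → graph-intro λ s′ x ex →
      ⇔I (λ s″ fx → describes-only d (⊆-trans s′ s″) x fx (⊩-mono s″ ex))
         (λ s″ x≐t → replace₁ F (≐-sym x≐t) (describes-holds (⊩-mono (⊆-trans s′ s″) d))))
    (λ s d → describes-intro (⇔E₂ (graph-elim d (⊩-mono s et)) (=Iⁿ (⊩-mono s et))) (⊩-mono s et)
      λ s′ w fw ew → ⇔E₁ (graph-elim (⊩-mono s′ d) ew) fw)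

  Δt-ι : (G : Form 1) (t : Term 0) → Γ ⊩ the (renT suc t ≐ bv zero) G ⇔ (E! t ∧' open₁ G t)
  Δt-ι G t = ⇔I
    (λ s d → ιE¹ d λ s′ w t≐w gw _ →
      let t≐w′ = ⊩-resp-≡ (open₁-≐-weakenˡ t (fv w)) t≐w
      in ∧I (AD-≐₁ t≐w′) (replace₁ G (≐-sym t≐w′) gw))
    (λ s d → ιI (⊩-resp-≡ (sym (open₁-≐-weakenˡ t t)) (=Iⁿ (∧E₁ d))) (∧E₂ d) (∧E₁ d)
      λ s′ w t≐w _ → ≐-sym (⊩-resp-≡ (open₁-≐-weakenˡ t (fv w)) t≐w))

  Δι-ι : (F G : Form 1) → Γ ⊩ the F G ⇔ ex (the (renF inject₁ F) (bv zero ≐ bv (suc zero)) ∧' G)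
  Δι-ι F G = ⇔I
    (λ s d → ιE¹ d λ s′ z fz gz ez →
      ∃I (⊩-resp-≡ (sym (body (fv z))) (∧I (the-describes (⊩-mono s′ d) fz ez) gz)) ez)
    (λ s d → ∃E d λ s′ y p ey → let p′ = ⊩-resp-≡ (body (fv y)) p in
      ιI (describes-holds (∧E₁ p′)) (∧E₂ p′) ey (describes-only (∧E₁ p′)))
    where
    body : ∀ u → open₁ (the (renF inject₁ F) (bv zero ≐ bv (suc zero)) ∧' G) u ≡ (F describes u ∧' open₁ G u)
    body u = cong (λ X → the X _ ∧' open₁ G u) (subF-liftS-single-inject₁ u F)

  infix 7 _denotes_
  _denotes_ : GTerm 0 → Term 0 → Form 0
  g denotes z = τ (g LLΔ.≐ tm z)

  open₁-the-renF : (D : LForm 1) (z : Term 0) →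
    open₁ (the (renF (liftR suc) (τ D)) (bv (suc zero) ≐ bv zero)) z ≡ the (τ D) (renT suc z ≐ bv zero)
  open₁-the-renF D z =
    cong (λ X → the X _) (subF-renF-inverse (liftS (single z)) (liftR suc) (λ { zero → refl }) (τ D))

  τ≐-elim : (g h : GTerm 0) → Γ ⊩ τ (g LLΔ.≐ h) →
            (∀[ Δ ⊇ Γ ] ∀ z → Δ ⊩ g denotes z → Δ ⊩ h denotes z → Δ ⊩ C) → Γ ⊩ C
  τ≐-elim (tm a) (tm b) d k = k ⊆-refl b d (=Iⁿ (AD-≐₂ d))
  τ≐-elim (ι C) (tm b) d k = k ⊆-refl b d (=Iⁿ (describes-E! d))
  τ≐-elim (tm a) (ι D) d k = k ⊆-refl a (=Iⁿ (describes-E! (⇔E₁ describes-flip d))) (⇔E₁ describes-flip d)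
  τ≐-elim (ι C) (ι D) d k = ιE¹ d λ s z cz dz ez →
    k s (fv z) (the-describes (⊩-mono s d) cz ez) (⇔E₁ describes-flip (⊩-resp-≡ (open₁-the-renF D (fv z)) dz))

  τ≐-intro : (g h : GTerm 0) (z : Term 0) → Γ ⊩ g denotes z → Γ ⊩ h denotes z → Γ ⊩ τ (g LLΔ.≐ h)
  τ≐-intro (tm a) (tm b) z gz hz = ≐-trans gz (≐-sym hz)
  τ≐-intro (ι C) (tm b) z gz hz = describes-resp gz (≐-sym hz)
  τ≐-intro (tm a) (ι D) z gz hz = ⇔E₂ describes-flip (describes-resp hz (≐-sym gz))
  τ≐-intro (ι C) (ι D) z gz hz =
    ιI (describes-holds gz) (⊩-resp-≡ (sym (open₁-the-renF D z)) (⇔E₂ describes-flip hz))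
       (describes-E! gz) (describes-only gz)

  τΔ-elim : (B : LForm 1) (g : GTerm 0) → Γ ⊩ τ (LLΔ.Δ B g) →
            (∀[ Δ ⊇ Γ ] ∀ z → Δ ⊩ g denotes z → Δ ⊩ open₁ (τ B) z → Δ ⊩ C) → Γ ⊩ C
  τΔ-elim B (tm a) d k = ιE¹ d λ s w aw bw _ → k s (fv w) (⊩-resp-≡ (open₁-≐-weakenˡ a (fv w)) aw) bw
  τΔ-elim B (ι C) d k = ιE¹ d λ s w cw bw ew → k s (fv w) (the-describes (⊩-mono s d) cw ew) bw

  τΔ-intro : (B : LForm 1) (g : GTerm 0) (z : Term 0) → Γ ⊩ g denotes z → Γ ⊩ open₁ (τ B) z →
             Γ ⊩ τ (LLΔ.Δ B g)
  τΔ-intro B (tm a) z gz bz = ιI (⊩-resp-≡ (sym (open₁-≐-weakenˡ a z)) gz) bz (AD-≐₂ gz)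
    λ s w aw _ → ≐-trans (≐-sym (⊩-resp-≡ (open₁-≐-weakenˡ a (fv w)) aw)) (⊩-mono s gz)
  τΔ-intro B (ι C) z gz bz = ιI (describes-holds gz) bz (describes-E! gz) (describes-only gz)

  τ-open₁ : (A : LForm 1) (u : Term 0) → open₁ (τ A) u ≡ τ (LLΔ.open₁ A u)
  τ-open₁ A u = sym (τ-subL (single u) A)

  τ≐-cong : ∀ {g g′ h h′} →
            (∀ z → Γ ⊩ g denotes z ⇔ g′ denotes z) → (∀ z → Γ ⊩ h denotes z ⇔ h′ denotes z) →
            Γ ⊩ τ (g LLΔ.≐ h) ⇔ τ (g′ LLΔ.≐ h′)
  τ≐-cong eg eh = ⇔I (transport eg eh) (transport (⇔-sym ∘ eg) (⇔-sym ∘ eh))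
    where
    transport : ∀ {g g′ h h′} →
                (∀ z → Γ ⊩ g denotes z ⇔ g′ denotes z) → (∀ z → Γ ⊩ h denotes z ⇔ h′ denotes z) →
                ∀[ Δ ⊇ Γ ] (Δ ⊩ τ (g LLΔ.≐ h) → Δ ⊩ τ (g′ LLΔ.≐ h′))
    transport {g = g} {g′} {h} {h′} eg eh s d = τ≐-elim g h d λ s′ z gz hz →
      τ≐-intro g′ h′ z (⇔E₁ (⊩-mono (⊆-trans s s′) (eg z)) gz) (⇔E₁ (⊩-mono (⊆-trans s s′) (eh z)) hz)

  τΔ-cong : ∀ {B B′ g g′} →
            (∀ z → Γ ⊩ g denotes z ⇔ g′ denotes z) → (∀ z → Γ ⊩ open₁ (τ B) z ⇔ open₁ (τ B′) z) →
            Γ ⊩ τ (LLΔ.Δ B g) ⇔ τ (LLΔ.Δ B′ g′)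
  τΔ-cong eg eB = ⇔I (transport eg eB) (transport (⇔-sym ∘ eg) (⇔-sym ∘ eB))
    where
    transport : ∀ {B B′ g g′} →
                (∀ z → Γ ⊩ g denotes z ⇔ g′ denotes z) → (∀ z → Γ ⊩ open₁ (τ B) z ⇔ open₁ (τ B′) z) →
                ∀[ Δ ⊇ Γ ] (Δ ⊩ τ (LLΔ.Δ B g) → Δ ⊩ τ (LLΔ.Δ B′ g′))
    transport {B = B} {B′} {g} {g′} eg eB s d = τΔ-elim B g d λ s′ z gz bz →
      τΔ-intro B′ g′ z (⇔E₁ (⊩-mono (⊆-trans s s′) (eg z)) gz) (⇔E₁ (⊩-mono (⊆-trans s s′) (eB z)) bz)

  -- Unlike g denotes r, a plain term refers to itself even when it is not known to exist.
  infix 2 _⊩_↦_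
  data _⊩_↦_ (Γ : Ctx) : GTerm 0 → Term 0 → Set where
    plain     : ∀ {a r} → Identified Γ a r → Γ ⊩ tm a ↦ r
    described : ∀ {C r} → Γ ⊩ ι C denotes r → Γ ⊩ ι C ↦ r

  ↦-mono : ∀ {Δ g r} → Γ ⊆ Δ → Γ ⊩ g ↦ r → Δ ⊩ g ↦ r
  ↦-mono s (plain p)     = plain (Identified-mono s p)
  ↦-mono s (described d) = described (⊩-mono s d)

  denotes⇒↦ : ∀ {z} (g : GTerm 0) → Γ ⊩ g denotes z → Γ ⊩ g ↦ z
  denotes⇒↦ (tm a) d = plain (inj₂ d)
  denotes⇒↦ (ι C)  d = described d

  Referents : Ctx → GSub k 0 → Sub k 0 → Set
  Referents Γ γ ρ = ∀ i → Γ ⊩ γ i ↦ ρ i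

  Referents-extend : ∀ {Δ} (u : Term 0) → Γ ⊆ Δ → Referents Γ γ ρ → Referents Δ (tm u ∷ₛ γ) (u ∷ₛ ρ)
  Referents-extend u s h zero    = plain (inj₁ refl)
  Referents-extend u s h (suc i) = ↦-mono s (h i)

  -- Where γ is a description the value is irrelevant: gsubT fails there.
  plainPart : GSub k 0 → Sub k 0 → Sub k 0
  plainPart γ ρ i = plainOr (γ i) (ρ i)
    where
    plainOr : GTerm 0 → Term 0 → Term 0
    plainOr (tm a) r = a
    plainOr (ι C)  r = r

  plainPart-≈ : Referents Γ γ ρ → plainPart γ ρ ≈[ Γ ] ρ
  plainPart-≈ {γ = γ} h i with γ i | h i
  ... | tm a | plain p     = p
  ... | ι C  | described _ = inj₁ refl

  gsubT-plainPart : ∀ t {t′} → gsubT γ t ≡ just t′ → t′ ≡ subT (plainPart γ ρ) t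
  gsubT-plainPart {γ = γ} (bv i) e with γ i
  gsubT-plainPart (bv i) refl | tm a = refl
  gsubT-plainPart (fv a)  refl = refl
  gsubT-plainPart (con c) refl = refl

  gsubTs-plainPart : ∀ ts {ts′} → gsubTs γ ts ≡ just ts′ → ts′ ≡ map (subT (plainPart γ ρ)) ts
  gsubTs-plainPart [] refl = refl
  gsubTs-plainPart {γ = γ} (t ∷ ts) e with gsubT γ t in et | gsubTs γ ts in ets
  gsubTs-plainPart (t ∷ ts) refl | just _ | just _ = cong₂ _∷_ (gsubT-plainPart t et) (gsubTs-plainPart ts ets)

  τ-open₁-subL-liftS : (A : LForm (suc k)) (u : Term 0) → open₁ (τ (subL (liftS ρ) A)) u ≡ τ (subL (u ∷ₛ ρ) A)
  τ-open₁-subL-liftS {ρ = ρ} A u = trans (τ-open₁ (subL (liftS ρ) A) u) (cong τ (open₁-subL-liftS ρ u A))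

  τ-SubstG : ∀ {g g′} → SubstG γ g g′ → Referents Γ γ ρ → ∀ z → Γ ⊩ g′ denotes z ⇔ subG ρ g denotes z
  τ-Subst : ∀ {A A′} → Subst γ A A′ → Referents Γ γ ρ → Γ ⊩ τ A′ ⇔ τ (subL ρ A)
  τ-Subst-body : ∀ {A A′} → Subst (gliftS γ) A A′ → Referents Γ γ ρ →
                 ∀[ Δ ⊇ Γ ] ∀ u → Δ ⊩ open₁ (τ A′) u ⇔ open₁ (τ (subL (liftS ρ) A)) u

  τ-SubstG {γ = γ} {ρ = ρ} (var i) h z with γ i | h i
  ... | tm a | plain p = ⇔I (λ s → ≐-resp (Identified-mono s p) (inj₁ refl))
                            (λ s → ≐-resp (Identified-sym (Identified-mono s p)) (inj₁ refl))
  ... | ι C  | described d = ⇔I (λ s → describes-unique (⊩-mono s d)) (λ s → describes-resp (⊩-mono s d))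
  τ-SubstG (fv a)  h z = ⇔-refl
  τ-SubstG (con c) h z = ⇔-refl
  τ-SubstG (ι A)   h z = the-cong (λ s y → τ-Subst-body A h s (fv y)) (λ _ _ → ⇔-refl)

  τ-Subst (pred {P = P} {ts} e) h =
    ⊩-resp-≡ (cong (λ us → Iota.pred P us ⇔ _) (sym (gsubTs-plainPart ts e))) (pred-cong ts (plainPart-≈ h))
  τ-Subst (E! {t = t} e) h =
    ⊩-resp-≡ (cong (λ u → Iota.E! u ⇔ _) (sym (gsubT-plainPart t e))) (E!-cong t (plainPart-≈ h))
  τ-Subst (s ≐ t)  h = τ≐-cong (τ-SubstG s h) (τ-SubstG t h)
  τ-Subst ⊥'       h = ⇔-refl
  τ-Subst (A ∧' B) h = ∧-cong (τ-Subst A h) (τ-Subst B h)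
  τ-Subst (A ∨' B) h = ∨-cong (τ-Subst A h) (τ-Subst B h)
  τ-Subst (A ⇒ B)  h = ⇒-cong (τ-Subst A h) (τ-Subst B h)
  τ-Subst (A ⇔ B)  h = ⇔-cong (τ-Subst A h) (τ-Subst B h)
  τ-Subst (all A)  h = all-cong λ s y → τ-Subst-body A h s (fv y)
  τ-Subst (ex A)   h = ex-cong λ s y → τ-Subst-body A h s (fv y)
  τ-Subst (Δ B g)  h = τΔ-cong (τ-SubstG g h) (τ-Subst-body B h ⊆-refl)

  τ-Subst-body {A = A} {A′} sA h s u =
    ⊩-resp-≡ (sym (cong₂ _⇔_ (τ-open₁ A′ u) (τ-open₁-subL-liftS A u)))
      (τ-Subst (Subst-open₁ u sA) (Referents-extend u s h))

  τ-=E : (A : LForm 1) {g h : GTerm 0} {B₁ B₂ : LForm 0} → gopen₁ A g ≡ just B₁ → gopen₁ A h ≡ just B₂ →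
         Γ ⊩ τ (g LLΔ.≐ h) → Γ ⊩ τ B₁ → Γ ⊩ τ B₂
  τ-=E A {g} {h} eg eh g≐h b = τ≐-elim g h g≐h λ s z gz hz →
    ⇔E₂ (τ-Subst (gsubL-graph A eh) (single-referent (denotes⇒↦ h hz)))
        (⇔E₁ (τ-Subst (gsubL-graph A eg) (single-referent (denotes⇒↦ g gz))) (⊩-mono s b))
    where
    single-referent : ∀ {Δ g z} → Δ ⊩ g ↦ z → Referents Δ (gsingle g) (single z)
    single-referent r zero = r

  τ-lambert : (A : LForm 1) → Γ ⊩ τ (LLΔ.lambert A)
  τ-lambert A = ⊩-resp-≡ (cong (λ X → all (the X _ ⇔ all (X ⇔ _))) (sym (τ-renL inject₁ A)))
    (∀I λ s y ey →
      ⊩-resp-≡ (cong (λ X → the X _ ⇔ all (X ⇔ _)) (sym (subF-liftS-single-inject₁ (fv y) (τ A))))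
      (lambert-ι (τ A) ey))

  τ-Δt : (B : LForm 1) (t : Term 0) → Γ ⊩ τ (LLΔ.Δt-ax B t)
  τ-Δt B t =
    ⊩-resp-≡ (cong (λ X → the (renT suc t ≐ bv zero) (τ B) ⇔ (E! t ∧' X)) (τ-open₁ B t)) (Δt-ι (τ B) t)

  τ-Δι : (A B : LForm 1) → Γ ⊩ τ (LLΔ.Δι-ax A B)
  τ-Δι A B = ⊩-resp-≡ (cong (λ X → the (τ A) (τ B) ⇔ ex (the X _ ∧' τ B)) (sym (τ-renL inject₁ A)))
                       (Δι-ι (τ A) (τ B))

  τ-AD-≐₁ : (g : GTerm 0) → Γ ⊩ τ (tm t LLΔ.≐ g) → Γ ⊩ E! t
  τ-AD-≐₁ {t = t} g d = τ≐-elim (tm t) g d λ _ _ t≐z _ → AD-≐₁ t≐z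

  τ-AD-≐₂ : (g : GTerm 0) → Γ ⊩ τ (g LLΔ.≐ tm t) → Γ ⊩ E! t
  τ-AD-≐₂ {t = t} g d = τ≐-elim g (tm t) d λ _ _ _ t≐z → AD-≐₁ t≐z

  τ-sound : ∀ {Γ A} → Γ LLΔ.⊢ A → map τ Γ Iota.⊢ τ A
  τ-sound (LLΔ.ass p)      = Iota.ass (∈-map⁺ τ p)
  τ-sound (LLΔ.∧I d e)     = Iota.∧I (τ-sound d) (τ-sound e)
  τ-sound (LLΔ.∧E₁ d)      = Iota.∧E₁ (τ-sound d)
  τ-sound (LLΔ.∧E₂ d)      = Iota.∧E₂ (τ-sound d)
  τ-sound (LLΔ.∨I₁ d)      = Iota.∨I₁ (τ-sound d)
  τ-sound (LLΔ.∨I₂ d)      = Iota.∨I₂ (τ-sound d)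
  τ-sound (LLΔ.∨E d e f)   = Iota.∨E (τ-sound d) (τ-sound e) (τ-sound f)
  τ-sound (LLΔ.⇒I d)       = Iota.⇒I (τ-sound d)
  τ-sound (LLΔ.⇒E d e)     = Iota.⇒E (τ-sound d) (τ-sound e)
  τ-sound (LLΔ.⇔I d e)     = Iota.⇔I (τ-sound d) (τ-sound e)
  τ-sound (LLΔ.⇔E₁ d e)    = Iota.⇔E₁ (τ-sound d) (τ-sound e)
  τ-sound (LLΔ.⇔E₂ d e)    = Iota.⇔E₂ (τ-sound d) (τ-sound e)
  τ-sound {A = A} (LLΔ.⊥E _ d) =
    admissible (λ { (d ∷ []) → ⊩-resp-≡ (subF-id (λ _ → refl) (τ A)) (ex-falso (τ A) bv d) }) (τ-sound d ∷ [])
  τ-sound {Γ} (LLΔ.∀I {A} y y∉Γ y∉A d) =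
    Iota.∀I y (y∉Γ ∘ namesCtx-τ Γ) (y∉A ∘ names-τ A)
      (subst (_ Iota.⊢_) (sym (τ-open₁ A (fv y))) (τ-sound d))
  τ-sound (LLΔ.∀E {A} {t} d e) = subst (_ Iota.⊢_) (τ-open₁ A t) (Iota.∀E (τ-sound d) (τ-sound e))
  τ-sound (LLΔ.∃I {A} {t} d e) = Iota.∃I (subst (_ Iota.⊢_) (sym (τ-open₁ A t)) (τ-sound d)) (τ-sound e)
  τ-sound {Γ} {C} (LLΔ.∃E {A} y y∉Γ y∉A y∉C d e) =
    Iota.∃E y (y∉Γ ∘ namesCtx-τ Γ) (y∉A ∘ names-τ A) (y∉C ∘ names-τ C) (τ-sound d)
      (subst (λ X → X ∷ _ Iota.⊢ _) (sym (τ-open₁ A (fv y))) (τ-sound e))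
  τ-sound (LLΔ.=Iⁿ d)      = Iota.=Iⁿ (τ-sound d)
  τ-sound (LLΔ.=E A _ e₁ e₂ d e) =
    admissible (λ { (d ∷ e ∷ []) → τ-=E A e₁ e₂ d e }) (τ-sound d ∷ τ-sound e ∷ [])
  τ-sound (LLΔ.AD-pred d p) = Iota.AD-pred (τ-sound d) p
  τ-sound (LLΔ.AD-E! d)     = Iota.AD-E! (τ-sound d)
  τ-sound (LLΔ.AD-≐₁ {s = g} d) = admissible (λ { (d ∷ []) → τ-AD-≐₁ g d }) (τ-sound d ∷ [])
  τ-sound (LLΔ.AD-≐₂ {s = g} d) = admissible (λ { (d ∷ []) → τ-AD-≐₂ g d }) (τ-sound d ∷ [])
  τ-sound (LLΔ.LL A)       = ⊩⇒⊢ (τ-lambert A)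
  τ-sound (LLΔ.Δt B t)     = ⊩⇒⊢ (τ-Δt B t)
  τ-sound (LLΔ.Δι A B)     = ⊩⇒⊢ (τ-Δι A B)

open υ-Translation using (υ-sound)
open τ-Translation using (τ-sound)

theorem2 : ((Γ : List (Iota.Form 0)) (A : Iota.Form 0) →
             Γ Iota.⊢ A → map υ Γ LLΔ.⊢ υ A)
         × ((Γ : List (LLΔ.LForm 0)) (A : LLΔ.LForm 0) →
             Γ LLΔ.⊢ A → map τ Γ Iota.⊢ τ A)
theorem2 = (λ _ _ → υ-sound) , (λ _ _ → τ-sound)
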